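{- Let $p$ be a prime and $n$ a positive integer. If $A\subseteq \mathbb{F}_p^n$ is not contained in the zero set of any nonzero polynomial in $\mathbb{F}_p[X_1,\dots,X_n]$ of degree $\le n$, then the $(p-1)$-fold sumset satisfies \[ \underbrace{A+\cdots+A}_{p-1\text{ times}}=\mathbb{F}_p^n. \]
   Context: For sets $A,B$ in an abelian group, $A+B=\{a+b: a\in A, b\in B\}$; iterated sumsets are defined analogously. -}

module Defs where

open import Data.Nat using (ℕ; zero; suc; _+_; _*_; _<_; NonZero)
open import Data.Nat.DivMod using (_mod_)
open import Data.Fin using (Fin; toℕ)
open import Data.Vec using (Vec; []; _∷_; zipWith; replicate; foldr; toList)
open import Data.List using (List; [_]; map; concatMap; allFin)
open import Data.Nat.ListAction using (sum)
open import Data.Product using (∃)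
open import Relation.Binary.PropositionalEquality using (_≡_; _≢_)

module _ {p : ℕ} .{{_ : NonZero p}} where

  zeroF : Fin p
  zeroF = 0 mod p

  oneF : Fin p
  oneF = 1 mod p

  _+F_ : Fin p → Fin p → Fin p
  a +F b = (toℕ a + toℕ b) mod p

  _*F_ : Fin p → Fin p → Fin p
  a *F b = (toℕ a * toℕ b) mod p

  powF : Fin p → ℕ → Fin p
  powF a zero    = oneF
  powF a (suc k) = a *F powF a k

Point : ℕ → ℕ → Set
Point p n = Vec (Fin p) n

module _ {p : ℕ} .{{_ : NonZero p}} where

  vzero : ∀ {n} → Point p n
  vzero = replicate _ zeroF

  _+V_ : ∀ {n} → Point p n → Point p n → Point p n
  _+V_ = zipWith _+F_

  sumPts : ∀ {n k} → Vec (Point p n) k → Point p n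
  sumPts = foldr _ _+V_ vzero

allVecs : ∀ {m} n → List (Vec (Fin m) n)
allVecs zero = [ [] ]
allVecs {m} (suc n) = concatMap (λ i → map (i ∷_) (allVecs n)) (allFin m)

-- Exponent vectors for monomials X₁^{e₁}⋯X_n^{e_n}; a polynomial of total
-- degree ≤ n has every individual exponent ≤ n, so Fin (suc n) suffices.
Exps : ℕ → Set
Exps n = Vec (Fin (suc n)) n

totalDeg : ∀ {n} → Exps n → ℕ
totalDeg e = sum (toList (Data.Vec.map toℕ e))
  where import Data.Vec

record PolyDegLe (p n : ℕ) .{{_ : NonZero p}} : Set where
  field
    coeff    : Exps n → Fin p
    degBound : ∀ e → n < totalDeg e → coeff e ≡ zeroF

open PolyDegLe public

module _ {p n : ℕ} .{{_ : NonZero p}} where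

  NonzeroPoly : PolyDegLe p n → Set
  NonzeroPoly P = ∃ λ (e : Exps n) → coeff P e ≢ zeroF

  monomial : Point p n → Exps n → Fin p
  monomial x e = foldr _ _*F_ oneF (zipWith (λ xi ei → powF xi (toℕ ei)) x e)

  eval : PolyDegLe p n → Point p n → Fin p
  eval P x = Data.List.foldr _+F_ zeroF
               (map (λ e → coeff P e *F monomial x e) (allVecs n))
    where import Data.List

-- Fix y and put k = p - 1. The polynomial G(z) = ∏ⱼ ∏_{c=1}^{k} (c - (zⱼ - yⱼ)) has degree kn and vanishes at
-- every z ≠ y but not at y, so it suffices to find a signed measure w supported on A with
-- ∫ G(x₁ + ⋯ + x_k) dw(x₁) ⋯ dw(x_k) ≠ 0. For the alternating measure ν on the vertices of the cube
-- -y + {0,1}ⁿ this k-fold integral equals G(y) ≠ 0, and ν kills every polynomial of degree below n.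
-- Since no nonzero polynomial of degree ≤ n vanishes on A, linear algebra yields a measure w on A whose
-- moments of degree ≤ n are κ ≠ 0 times those of ν. Expanding G(x₁ + ⋯ + x_k) into monomials
-- x₁^e₁ ⋯ x_k^e_k with Σ ∣eᵢ∣ ≤ kn, each one either has all ∣eᵢ∣ = n or some ∣eᵢ∣ < n; hence the k-fold
-- integral against w is κ^k times the one against ν, so it is nonzero and some x₁, …, x_k ∈ A have
-- G(x₁ + ⋯ + x_k) ≠ 0, that is, x₁ + ⋯ + x_k = y.

module Submission where

open import Algebra.Bundles using (CommutativeRing)
open import Algebra.Structures using (IsCommutativeRing)
import Algebra.Solver.Ring.AlmostCommutativeRing as ACR
open import Algebra.Solver.Ring.AlmostCommutativeRing using (_-Raw-AlmostCommutative⟶_)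
open import Data.Bool using (Bool; true; false; if_then_else_)
import Data.Bool.Properties as Bool
open import Data.Empty using (⊥-elim)
open import Data.Fin as Fin using (Fin; toℕ; fromℕ<; _≟_)
open import Data.Fin.Properties using (toℕ-injective; toℕ-fromℕ<; toℕ<n)
open import Data.Integer as ℤ using (ℤ; +_; -[1+_])
import Data.Integer.Properties as ℤ
open import Data.List as List using (List; []; _∷_; _++_; map; filter; foldr; concatMap; upTo; allFin; cartesianProductWith)
import Data.List.Properties as List
open import Data.List.Membership.Propositional using (_∈_; find)
open import Data.List.Membership.Propositional.Properties
  using (∈-allFin; ∈-map⁺; ∈-map⁻; ∈-upTo⁺; ∈-upTo⁻; ∈-filter⁺; ∈-filter⁻; ∈-cartesianProductWith⁺)
import Data.List.Relation.Unary.All as All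
import Data.List.Relation.Unary.All.Properties as AllP
open import Data.List.Relation.Unary.AllPairs using ([]; _∷_)
open import Data.List.Relation.Unary.Any using (here; there)
open import Data.List.Relation.Unary.Unique.Propositional using (Unique)
import Data.List.Relation.Unary.Unique.Propositional.Properties as Unique
open import Data.Maybe using (Maybe; just; nothing)
open import Data.Nat as ℕ using (ℕ; zero; suc; NonZero; _≤_; _<_; _∸_; _%_)
open import Data.Nat.Base using (nonTrivial⇒n>1)
open import Data.Nat.DivMod using (_mod_; m%n<n; m<n⇒m%n≡m; n%n≡0; %-distribˡ-+; %-distribˡ-*)
open import Data.Nat.Divisibility using (_∣_; ∣⇒≤; m%n≡0⇒n∣m)
open import Data.Nat.ListAction using (sum)
open import Data.Nat.Primality using (Prime; prime⇒nonTrivial; euclidsLemma)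
import Data.Nat.Properties as ℕ
open import Algebra.Properties.CommutativeSemigroup ℕ.+-commutativeSemigroup using () renaming (interchange to ℕ-+-interchange)
open import Data.Product using (Σ-syntax; ∃; _,_; _×_; proj₁; proj₂)
open import Data.Sign as Sign using (Sign)
open import Data.Sum as Sum using (_⊎_; inj₁; inj₂)
open import Data.Vec as Vec using (Vec; []; _∷_; lookup; replicate; zipWith; head; tail; toList)
import Data.Vec.Properties as Vec
open import Data.Vec.Relation.Unary.All using () renaming (All to VecAll; [] to []ᵛ; _∷_ to _∷ᵛ_)
import Data.Vec.Relation.Unary.All.Properties as VecAll
open import Level using (Level; 0ℓ)
open import Relation.Binary.Definitions using (DecidableEquality; tri<; tri≈; tri>)
open import Relation.Binary.PropositionalEquality
  using (_≡_; _≢_; refl; sym; trans; cong; cong₂; subst; setoid; isEquivalence; module ≡-Reasoning)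
open import Relation.Nullary using (¬_; Dec; does; yes; no)
open import Relation.Nullary.Decidable using (dec-true; dec-false)
open import Relation.Unary using (Pred)

open import Defs

deg : ∀ {n} → Vec ℕ n → ℕ
deg e = sum (toList e)

unit : ∀ {n} → Fin n → Vec ℕ n
unit {suc n} Fin.zero    = 1 ∷ replicate n 0
unit         (Fin.suc j) = 0 ∷ unit j

deg-replicate-0 : ∀ n → deg (replicate n 0) ≡ 0
deg-replicate-0 zero    = refl
deg-replicate-0 (suc n) = deg-replicate-0 n

deg-unit : ∀ {n} (j : Fin n) → deg (unit j) ≡ 1
deg-unit {suc n} Fin.zero    = cong suc (deg-replicate-0 n)
deg-unit         (Fin.suc j) = deg-unit j

deg-+ : ∀ {n} (e e′ : Vec ℕ n) → deg (zipWith ℕ._+_ e e′) ≡ deg e ℕ.+ deg e′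
deg-+ []      []        = refl
deg-+ (a ∷ e) (a′ ∷ e′) = trans (cong (a ℕ.+ a′ ℕ.+_) (deg-+ e e′)) (ℕ-+-interchange a a′ (deg e) (deg e′))

boundedExps : ∀ {m} N (e : Vec ℕ m) → deg e ≤ N → Vec (Fin (suc N)) m
boundedExps N []      _     = []
boundedExps N (a ∷ e) deg≤N = fromℕ< (ℕ.s≤s (ℕ.≤-trans (ℕ.m≤m+n a (deg e)) deg≤N))
                            ∷ boundedExps N e (ℕ.≤-trans (ℕ.m≤n+m (deg e) a) deg≤N)

toℕ-boundedExps : ∀ {m} N (e : Vec ℕ m) (deg≤N : deg e ≤ N) → Vec.map toℕ (boundedExps N e deg≤N) ≡ e
toℕ-boundedExps N []      _     = refl
toℕ-boundedExps N (a ∷ e) deg≤N = cong₂ _∷_ (toℕ-fromℕ< _) (toℕ-boundedExps N e _)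

concatMap-map≡cartesianProductWith : ∀ {a b c} {X : Set a} {Y : Set b} {Z : Set c} (f : X → Y → Z) xs ys →
                                     concatMap (λ x → map (f x) ys) xs ≡ cartesianProductWith f xs ys
concatMap-map≡cartesianProductWith f []       ys = refl
concatMap-map≡cartesianProductWith f (x ∷ xs) ys = cong (map (f x) ys ++_) (concatMap-map≡cartesianProductWith f xs ys)

∈-allVecs : ∀ {m} n (v : Vec (Fin m) n) → v ∈ allVecs n
∈-allVecs zero    []      = here refl
∈-allVecs (suc n) (i ∷ v) = subst ((i ∷ v) ∈_) (sym (concatMap-map≡cartesianProductWith _∷_ (allFin _) (allVecs n)))
  (∈-cartesianProductWith⁺ _∷_ (∈-allFin i) (∈-allVecs n v))

allVecs-unique : ∀ {m} n → Unique (allVecs {m} n)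
allVecs-unique zero    = All.[] ∷ []
allVecs-unique (suc n) = subst Unique (sym (concatMap-map≡cartesianProductWith _∷_ (allFin _) (allVecs n)))
  (Unique.cartesianProductWith⁺ _∷_ Vec.∷-injective (Unique.allFin⁺ _) (allVecs-unique n))

-- 𝔽_p is Fin p with the operations of Defs. Since [_] : ℕ → 𝔽 is surjective and sends + and * to +F and *F,
-- every commutative-semiring law of 𝔽 is transported from ℕ.
module PrimeField (p : ℕ) .{{_ : NonZero p}} where

  𝔽 : Set
  𝔽 = Fin p

  [_] : ℕ → 𝔽
  [ a ] = a mod p

  -F_ : 𝔽 → 𝔽
  -F x = [ p ∸ toℕ x ]

  toℕ-[] : ∀ a → toℕ [ a ] ≡ a % p
  toℕ-[] a = toℕ-fromℕ< (m%n<n a p)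

  []-cong-% : ∀ {a b} → a % p ≡ b % p → [ a ] ≡ [ b ]
  []-cong-% {a} {b} eq = toℕ-injective (trans (toℕ-[] a) (trans eq (sym (toℕ-[] b))))

  [toℕ] : ∀ x → [ toℕ x ] ≡ x
  [toℕ] x = toℕ-injective (trans (toℕ-[] (toℕ x)) (m<n⇒m%n≡m (toℕ<n x)))

  []-+ : ∀ a b → [ a ℕ.+ b ] ≡ [ a ] +F [ b ]
  []-+ a b = []-cong-% (trans (%-distribˡ-+ a b p)
    (cong₂ (λ u v → (u ℕ.+ v) % p) (sym (toℕ-[] a)) (sym (toℕ-[] b))))

  []-* : ∀ a b → [ a ℕ.* b ] ≡ [ a ] *F [ b ]
  []-* a b = []-cong-% (trans (%-distribˡ-* a b p)
    (cong₂ (λ u v → (u ℕ.* v) % p) (sym (toℕ-[] a)) (sym (toℕ-[] b))))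

  toℕ-zeroF : toℕ zeroF ≡ 0
  toℕ-zeroF = trans (toℕ-[] 0) (m<n⇒m%n≡m (ℕ.>-nonZero⁻¹ p))

  []≡0⇒∣ : ∀ a → [ a ] ≡ zeroF → p ∣ a
  []≡0⇒∣ a eq = m%n≡0⇒n∣m a p (trans (sym (toℕ-[] a)) (trans (cong toℕ eq) toℕ-zeroF))

  []≢0 : ∀ {m} → 0 ℕ.< m → m ℕ.< p → [ m ] ≢ zeroF
  []≢0 {suc m} _ m<p eq = ℕ.<⇒≱ m<p (∣⇒≤ ([]≡0⇒∣ (suc m) eq))

  ∣toℕ⇒≡0 : ∀ x → p ∣ toℕ x → x ≡ zeroF
  ∣toℕ⇒≡0 x p∣x with toℕ x in eq
  ... | zero  = toℕ-injective (trans eq (sym toℕ-zeroF))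
  ... | suc m = ⊥-elim (ℕ.<⇒≱ (subst (ℕ._< p) eq (toℕ<n x)) (∣⇒≤ p∣x))

  [p]≡0 : [ p ] ≡ zeroF
  [p]≡0 = []-cong-% (trans (n%n≡0 p) (sym (m<n⇒m%n≡m (ℕ.>-nonZero⁻¹ p))))

  []-surjective-elim : {P : 𝔽 → Set} → (∀ a → P [ a ]) → ∀ x → P x
  []-surjective-elim {P} h x = subst P ([toℕ] x) (h (toℕ x))

  []-surjective-elim₃ : {P : 𝔽 → 𝔽 → 𝔽 → Set} → (∀ a b c → P [ a ] [ b ] [ c ]) → ∀ x y z → P x y z
  []-surjective-elim₃ {P} h x y z =
    []-surjective-elim {λ x → P x y z} (λ a → []-surjective-elim {λ y → P [ a ] y z} (λ b →
      []-surjective-elim {λ z → P [ a ] [ b ] z} (h a b) z) y) x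

  +F-assoc : ∀ x y z → (x +F y) +F z ≡ x +F (y +F z)
  +F-assoc = []-surjective-elim₃ λ a b c → begin
    ([ a ] +F [ b ]) +F [ c ] ≡⟨ cong (_+F [ c ]) ([]-+ a b) ⟨
    [ a ℕ.+ b ] +F [ c ]      ≡⟨ []-+ (a ℕ.+ b) c ⟨
    [ a ℕ.+ b ℕ.+ c ]         ≡⟨ cong [_] (ℕ.+-assoc a b c) ⟩
    [ a ℕ.+ (b ℕ.+ c) ]       ≡⟨ []-+ a (b ℕ.+ c) ⟩
    [ a ] +F [ b ℕ.+ c ]      ≡⟨ cong ([ a ] +F_) ([]-+ b c) ⟩
    [ a ] +F ([ b ] +F [ c ]) ∎
    where open ≡-Reasoning

  *F-assoc : ∀ x y z → (x *F y) *F z ≡ x *F (y *F z)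
  *F-assoc = []-surjective-elim₃ λ a b c → begin
    ([ a ] *F [ b ]) *F [ c ] ≡⟨ cong (_*F [ c ]) ([]-* a b) ⟨
    [ a ℕ.* b ] *F [ c ]      ≡⟨ []-* (a ℕ.* b) c ⟨
    [ a ℕ.* b ℕ.* c ]         ≡⟨ cong [_] (ℕ.*-assoc a b c) ⟩
    [ a ℕ.* (b ℕ.* c) ]       ≡⟨ []-* a (b ℕ.* c) ⟩
    [ a ] *F [ b ℕ.* c ]      ≡⟨ cong ([ a ] *F_) ([]-* b c) ⟩
    [ a ] *F ([ b ] *F [ c ]) ∎
    where open ≡-Reasoning

  *F-distribˡ-+F : ∀ x y z → x *F (y +F z) ≡ (x *F y) +F (x *F z)
  *F-distribˡ-+F = []-surjective-elim₃ λ a b c → begin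
    [ a ] *F ([ b ] +F [ c ])         ≡⟨ cong ([ a ] *F_) ([]-+ b c) ⟨
    [ a ] *F [ b ℕ.+ c ]              ≡⟨ []-* a (b ℕ.+ c) ⟨
    [ a ℕ.* (b ℕ.+ c) ]               ≡⟨ cong [_] (ℕ.*-distribˡ-+ a b c) ⟩
    [ a ℕ.* b ℕ.+ a ℕ.* c ]           ≡⟨ []-+ (a ℕ.* b) (a ℕ.* c) ⟩
    [ a ℕ.* b ] +F [ a ℕ.* c ]        ≡⟨ cong₂ _+F_ ([]-* a b) ([]-* a c) ⟩
    ([ a ] *F [ b ]) +F ([ a ] *F [ c ]) ∎
    where open ≡-Reasoning

  +F-comm : ∀ x y → x +F y ≡ y +F x
  +F-comm x y = cong [_] (ℕ.+-comm (toℕ x) (toℕ y))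

  *F-comm : ∀ x y → x *F y ≡ y *F x
  *F-comm x y = cong [_] (ℕ.*-comm (toℕ x) (toℕ y))

  +F-identityˡ : ∀ x → zeroF +F x ≡ x
  +F-identityˡ = []-surjective-elim λ a → sym ([]-+ 0 a)

  *F-identityˡ : ∀ x → oneF *F x ≡ x
  *F-identityˡ = []-surjective-elim λ a → trans (sym ([]-* 1 a)) (cong [_] (ℕ.*-identityˡ a))

  +F-identityʳ : ∀ x → x +F zeroF ≡ x
  +F-identityʳ x = trans (+F-comm x zeroF) (+F-identityˡ x)

  *F-identityʳ : ∀ x → x *F oneF ≡ x
  *F-identityʳ x = trans (*F-comm x oneF) (*F-identityˡ x)

  -F-inverseˡ : ∀ x → (-F x) +F x ≡ zeroF
  -F-inverseˡ x = begin
    (-F x) +F x                 ≡⟨ cong ((-F x) +F_) ([toℕ] x) ⟨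
    [ p ∸ toℕ x ] +F [ toℕ x ]  ≡⟨ []-+ (p ∸ toℕ x) (toℕ x) ⟨
    [ p ∸ toℕ x ℕ.+ toℕ x ]     ≡⟨ cong [_] (ℕ.m∸n+n≡m (ℕ.<⇒≤ (toℕ<n x))) ⟩
    [ p ]                       ≡⟨ [p]≡0 ⟩
    [ 0 ]                       ∎
    where open ≡-Reasoning

  𝔽-isCommutativeRing : IsCommutativeRing _≡_ _+F_ _*F_ -F_ zeroF oneF
  𝔽-isCommutativeRing = record
    { isRing = record
      { +-isAbelianGroup = record
        { isGroup = record
          { isMonoid = record
            { isSemigroup = record
              { isMagma = record { isEquivalence = isEquivalence ; ∙-cong = cong₂ _+F_ }
              ; assoc = +F-assoc }
            ; identity = +F-identityˡ , +F-identityʳ }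
          ; inverse = -F-inverseˡ , λ x → trans (+F-comm x (-F x)) (-F-inverseˡ x)
          ; ⁻¹-cong = cong -F_ }
        ; comm = +F-comm }
      ; *-cong = cong₂ _*F_
      ; *-assoc = *F-assoc
      ; *-identity = *F-identityˡ , *F-identityʳ
      ; distrib = *F-distribˡ-+F , λ x y z → trans (*F-comm (y +F z) x)
          (trans (*F-distribˡ-+F x y z) (cong₂ _+F_ (*F-comm x y) (*F-comm x z))) }
    ; *-comm = *F-comm }

  𝔽-commutativeRing : CommutativeRing 0ℓ 0ℓ
  𝔽-commutativeRing = record { isCommutativeRing = 𝔽-isCommutativeRing }

  open CommutativeRing 𝔽-commutativeRing public
    using () renaming (zeroˡ to *F-zeroˡ; zeroʳ to *F-zeroʳ; -‿inverseʳ to -F-inverseʳ)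
  open import Algebra.Properties.Group (CommutativeRing.+-group 𝔽-commutativeRing) public
    using () renaming (ε⁻¹≈ε to -F0≡0; ⁻¹-involutive to -F-involutive; inverseˡ-unique to -F-unique)
  open import Algebra.Properties.AbelianGroup (CommutativeRing.+-abelianGroup 𝔽-commutativeRing)
    using (⁻¹-∙-comm)
  open import Algebra.Properties.CommutativeSemigroup (CommutativeRing.+-commutativeSemigroup 𝔽-commutativeRing)
    using () renaming (interchange to +F-interchange)
  open import Algebra.Properties.Ring (CommutativeRing.ring 𝔽-commutativeRing)
    using (-‿distribˡ-*; -‿distribʳ-*)

  [p∸1]≡-1 : [ p ∸ 1 ] ≡ -F oneF
  [p∸1]≡-1 = -F-unique [ p ∸ 1 ] oneF (begin
    [ p ∸ 1 ] +F [ 1 ]  ≡⟨ []-+ (p ∸ 1) 1 ⟨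
    [ p ∸ 1 ℕ.+ 1 ]     ≡⟨ cong [_] (ℕ.m∸n+n≡m (ℕ.>-nonZero⁻¹ p)) ⟩
    [ p ]               ≡⟨ [p]≡0 ⟩
    zeroF               ∎)
    where open ≡-Reasoning

  x≡0⇒x*y≡0 : ∀ {x} y → x ≡ zeroF → x *F y ≡ zeroF
  x≡0⇒x*y≡0 y refl = *F-zeroˡ y

  y≡0⇒x*y≡0 : ∀ x {y} → y ≡ zeroF → x *F y ≡ zeroF
  y≡0⇒x*y≡0 x refl = *F-zeroʳ x

  -- The ring solver must decide equality of coefficients, which it cannot do in 𝔽 (p is a variable and
  -- [_] does not compute), so it is run with integer coefficients through the homomorphism fromℤ.
  signed : Sign → 𝔽 → 𝔽
  signed Sign.+ x = x
  signed Sign.- x = -F x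

  fromℤ : ℤ → 𝔽
  fromℤ i = signed (ℤ.sign i) [ ℤ.∣ i ∣ ]

  fromℤ-◃ : ∀ s n → fromℤ (s ℤ.◃ n) ≡ signed s [ n ]
  fromℤ-◃ Sign.+ zero    = refl
  fromℤ-◃ Sign.- zero    = sym -F0≡0
  fromℤ-◃ Sign.+ (suc n) = refl
  fromℤ-◃ Sign.- (suc n) = refl

  signed-* : ∀ s t x y → signed (s Sign.* t) (x *F y) ≡ signed s x *F signed t y
  signed-* Sign.+ Sign.+ x y = refl
  signed-* Sign.+ Sign.- x y = -‿distribʳ-* x y
  signed-* Sign.- Sign.+ x y = -‿distribˡ-* x y
  signed-* Sign.- Sign.- x y = begin
    x *F y                ≡⟨ cong₂ _*F_ (-F-involutive x) refl ⟨
    (-F (-F x)) *F y      ≡⟨ -‿distribˡ-* (-F x) y ⟨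
    -F ((-F x) *F y)      ≡⟨ -‿distribʳ-* (-F x) y ⟩
    (-F x) *F (-F y)      ∎
    where open ≡-Reasoning

  fromℤ-⊖ : ∀ m n → fromℤ (m ℤ.⊖ n) ≡ [ m ] +F (-F [ n ])
  fromℤ-⊖ m       zero    = begin
    fromℤ (m ℤ.⊖ 0)       ≡⟨ cong fromℤ (ℤ.⊖-≥ {m} ℕ.z≤n) ⟩
    [ m ]                 ≡⟨ +F-identityʳ [ m ] ⟨
    [ m ] +F zeroF        ≡⟨ cong ([ m ] +F_) -F0≡0 ⟨
    [ m ] +F (-F [ 0 ])   ∎
    where open ≡-Reasoning
  fromℤ-⊖ zero    (suc n) = sym (+F-identityˡ _)
  fromℤ-⊖ (suc m) (suc n) = begin
    fromℤ (suc m ℤ.⊖ suc n)                      ≡⟨ cong fromℤ (ℤ.[1+m]⊖[1+n]≡m⊖n m n) ⟩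
    fromℤ (m ℤ.⊖ n)                              ≡⟨ fromℤ-⊖ m n ⟩
    [ m ] +F (-F [ n ])                          ≡⟨ +F-identityˡ _ ⟨
    zeroF +F ([ m ] +F (-F [ n ]))               ≡⟨ cong (_+F ([ m ] +F (-F [ n ]))) (-F-inverseʳ [ 1 ]) ⟨
    ([ 1 ] +F (-F [ 1 ])) +F ([ m ] +F (-F [ n ])) ≡⟨ +F-interchange [ 1 ] (-F [ 1 ]) [ m ] (-F [ n ]) ⟩
    ([ 1 ] +F [ m ]) +F ((-F [ 1 ]) +F (-F [ n ])) ≡⟨ cong (([ 1 ] +F [ m ]) +F_) (⁻¹-∙-comm [ 1 ] [ n ]) ⟩
    ([ 1 ] +F [ m ]) +F (-F ([ 1 ] +F [ n ]))    ≡⟨ cong₂ (λ u v → u +F (-F v)) ([]-+ 1 m) ([]-+ 1 n) ⟨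
    [ suc m ] +F (-F [ suc n ])                  ∎
    where open ≡-Reasoning

  fromℤ-+ : ∀ i j → fromℤ (i ℤ.+ j) ≡ fromℤ i +F fromℤ j
  fromℤ-+ (+ m)    (+ n)    = []-+ m n
  fromℤ-+ (+ m)    -[1+ n ] = fromℤ-⊖ m (suc n)
  fromℤ-+ -[1+ m ] (+ n)    = trans (fromℤ-⊖ n (suc m)) (+F-comm [ n ] _)
  fromℤ-+ -[1+ m ] -[1+ n ] = begin
    -F [ suc (suc (m ℕ.+ n)) ]         ≡⟨ cong (λ k → -F [ suc k ]) (ℕ.+-suc m n) ⟨
    -F [ suc m ℕ.+ suc n ]             ≡⟨ cong -F_ ([]-+ (suc m) (suc n)) ⟩
    -F ([ suc m ] +F [ suc n ])        ≡⟨ ⁻¹-∙-comm [ suc m ] [ suc n ] ⟨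
    (-F [ suc m ]) +F (-F [ suc n ])   ∎
    where open ≡-Reasoning

  fromℤ-* : ∀ i j → fromℤ (i ℤ.* j) ≡ fromℤ i *F fromℤ j
  fromℤ-* i j = begin
    fromℤ (i ℤ.* j)                  ≡⟨ fromℤ-◃ s _ ⟩
    signed s [ ∣i∣ ℕ.* ∣j∣ ]          ≡⟨ cong (signed s) ([]-* ∣i∣ ∣j∣) ⟩
    signed s ([ ∣i∣ ] *F [ ∣j∣ ])     ≡⟨ signed-* (ℤ.sign i) (ℤ.sign j) _ _ ⟩
    fromℤ i *F fromℤ j               ∎
    where
    open ≡-Reasoning
    s = ℤ.sign i Sign.* ℤ.sign j
    ∣i∣ = ℤ.∣ i ∣
    ∣j∣ = ℤ.∣ j ∣

  fromℤ-neg : ∀ i → fromℤ (ℤ.- i) ≡ -F fromℤ i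
  fromℤ-neg (+ zero)  = sym -F0≡0
  fromℤ-neg (+ suc n) = refl
  fromℤ-neg -[1+ n ]  = sym (-F-involutive _)

  fromℤ-morphism : ℤ.+-*-rawRing -Raw-AlmostCommutative⟶ ACR.fromCommutativeRing 𝔽-commutativeRing
  fromℤ-morphism = record
    { ⟦_⟧ = fromℤ ; +-homo = fromℤ-+ ; *-homo = fromℤ-* ; -‿homo = fromℤ-neg ; 0-homo = refl ; 1-homo = refl }

  fromℤ-≟ : ∀ i j → Maybe (fromℤ i ≡ fromℤ j)
  fromℤ-≟ i j with i ℤ.≟ j
  ... | yes i≡j = just (cong fromℤ i≡j)
  ... | no _    = nothing

  open import Algebra.Solver.Ring ℤ.+-*-rawRing (ACR.fromCommutativeRing 𝔽-commutativeRing) fromℤ-morphism fromℤ-≟ public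
    using (solve; _:=_; _:+_; _:*_; :-_; con)

module FiniteSums (p : ℕ) .{{_ : NonZero p}} where

  open All using (All; []; _∷_)

  open PrimeField p public

  private
    variable
      a b c : Level
      A : Set a
      B : Set b
      C : Set c

  -- ∑ is foldr over map, so that eval from Defs is literally a ∑ over allVecs.
  ∑ : List A → (A → 𝔽) → 𝔽
  ∑ xs f = foldr _+F_ zeroF (map f xs)

  ∏ : List A → (A → 𝔽) → 𝔽
  ∏ xs f = foldr _*F_ oneF (map f xs)

  syntax ∑ xs (λ x → e) = ∑[ x ∈ xs ] e
  syntax ∏ xs (λ x → e) = ∏[ x ∈ xs ] e

  ∑-cong : ∀ (xs : List A) {f g : A → 𝔽} → (∀ x → f x ≡ g x) → ∑ xs f ≡ ∑ xs g
  ∑-cong []       eq = refl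
  ∑-cong (x ∷ xs) eq = cong₂ _+F_ (eq x) (∑-cong xs eq)

  ∑-cong-All : ∀ {xs : List A} {f g : A → 𝔽} → All (λ x → f x ≡ g x) xs → ∑ xs f ≡ ∑ xs g
  ∑-cong-All []         = refl
  ∑-cong-All (eq ∷ eqs) = cong₂ _+F_ eq (∑-cong-All eqs)

  ∑-zero : ∀ {xs : List A} {f : A → 𝔽} → All (λ x → f x ≡ zeroF) xs → ∑ xs f ≡ zeroF
  ∑-zero []         = refl
  ∑-zero (eq ∷ eqs) = trans (cong₂ _+F_ eq (∑-zero eqs)) (+F-identityˡ zeroF)

  ∑-distrib-+F : ∀ (xs : List A) (f g : A → 𝔽) → ∑[ x ∈ xs ] (f x +F g x) ≡ ∑ xs f +F ∑ xs g
  ∑-distrib-+F []       f g = sym (+F-identityˡ zeroF)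
  ∑-distrib-+F (x ∷ xs) f g = trans (cong ((f x +F g x) +F_) (∑-distrib-+F xs f g))
    (solve 4 (λ a b c d → (a :+ b) :+ (c :+ d) := (a :+ c) :+ (b :+ d)) refl (f x) (g x) (∑ xs f) (∑ xs g))

  *F-distribˡ-∑ : ∀ (xs : List A) c (f : A → 𝔽) → c *F ∑ xs f ≡ ∑[ x ∈ xs ] (c *F f x)
  *F-distribˡ-∑ []       c f = *F-zeroʳ c
  *F-distribˡ-∑ (x ∷ xs) c f = trans (*F-distribˡ-+F c (f x) (∑ xs f)) (cong ((c *F f x) +F_) (*F-distribˡ-∑ xs c f))

  ∑-++ : ∀ (xs ys : List A) (f : A → 𝔽) → ∑ (xs ++ ys) f ≡ ∑ xs f +F ∑ ys f
  ∑-++ []       ys f = sym (+F-identityˡ _)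
  ∑-++ (x ∷ xs) ys f = trans (cong (f x +F_) (∑-++ xs ys f)) (sym (+F-assoc (f x) (∑ xs f) (∑ ys f)))

  ∑-map : ∀ (g : A → B) (xs : List A) (f : B → 𝔽) → ∑ (map g xs) f ≡ ∑[ x ∈ xs ] f (g x)
  ∑-map g []       f = refl
  ∑-map g (x ∷ xs) f = cong (f (g x) +F_) (∑-map g xs f)

  ∑-++-map : ∀ (g h : A → B) (xs : List A) (f : B → 𝔽) →
             ∑ (map g xs ++ map h xs) f ≡ ∑[ x ∈ xs ] (f (g x) +F f (h x))
  ∑-++-map g h xs f = begin
    ∑ (map g xs ++ map h xs) f           ≡⟨ ∑-++ (map g xs) (map h xs) f ⟩
    ∑ (map g xs) f +F ∑ (map h xs) f     ≡⟨ cong₂ _+F_ (∑-map g xs f) (∑-map h xs f) ⟩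
    ∑ xs (λ x → f (g x)) +F ∑ xs (λ x → f (h x)) ≡⟨ ∑-distrib-+F xs _ _ ⟨
    ∑[ x ∈ xs ] (f (g x) +F f (h x))     ∎
    where open ≡-Reasoning

  ∑-comm : ∀ (xs : List A) (ys : List B) (f : A → B → 𝔽) →
           ∑[ x ∈ xs ] ∑[ y ∈ ys ] f x y ≡ ∑[ y ∈ ys ] ∑[ x ∈ xs ] f x y
  ∑-comm []       ys f = sym (∑-zero {xs = ys} (All.tabulate (λ _ → refl)))
  ∑-comm (x ∷ xs) ys f = trans (cong (∑ ys (f x) +F_) (∑-comm xs ys f))
    (sym (∑-distrib-+F ys (f x) (λ y → ∑[ x′ ∈ xs ] f x′ y)))

  ∑-cartesianProductWith : ∀ (_·_ : A → B → C) (xs : List A) (ys : List B) (h : C → 𝔽) (f : A → 𝔽) (g : B → 𝔽) →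
    (∀ x y → h (x · y) ≡ f x *F g y) → ∑ (cartesianProductWith _·_ xs ys) h ≡ ∑ xs f *F ∑ ys g
  ∑-cartesianProductWith _·_ []       ys h f g eq = sym (*F-zeroˡ (∑ ys g))
  ∑-cartesianProductWith _·_ (x ∷ xs) ys h f g eq = begin
    ∑ (map (x ·_) ys ++ cartesianProductWith _·_ xs ys) h         ≡⟨ ∑-++ (map (x ·_) ys) _ h ⟩
    ∑ (map (x ·_) ys) h +F ∑ (cartesianProductWith _·_ xs ys) h  ≡⟨ cong₂ _+F_ (∑-map (x ·_) ys h)
                                                                     (∑-cartesianProductWith _·_ xs ys h f g eq) ⟩
    (∑[ y ∈ ys ] h (x · y)) +F (∑ xs f *F ∑ ys g)                ≡⟨ cong (_+F (∑ xs f *F ∑ ys g))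
                                                                     (trans (∑-cong ys (eq x)) (sym (*F-distribˡ-∑ ys (f x) g))) ⟩
    (f x *F ∑ ys g) +F (∑ xs f *F ∑ ys g)                        ≡⟨ solve 3 (λ a b c → a :* c :+ b :* c := (a :+ b) :* c)
                                                                     refl (f x) (∑ xs f) (∑ ys g) ⟩
    (f x +F ∑ xs f) *F ∑ ys g                                    ∎
    where open ≡-Reasoning

  ∑-filter : ∀ {P : Pred A c} (P? : ∀ x → Dec (P x)) (xs : List A) (f : A → 𝔽) →
             ∑[ x ∈ xs ] (if does (P? x) then f x else zeroF) ≡ ∑ (filter P? xs) f
  ∑-filter P? []       f = refl
  ∑-filter P? (x ∷ xs) f with does (P? x)
  ... | true  = cong (f x +F_) (∑-filter P? xs f)
  ... | false = trans (+F-identityˡ _) (∑-filter P? xs f)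

  ∑≢0⇒∃≢0 : ∀ (xs : List A) (f : A → 𝔽) → ∑ xs f ≢ zeroF → Σ[ x ∈ A ] x ∈ xs × f x ≢ zeroF
  ∑≢0⇒∃≢0 []       f ∑≢0 with () ← ∑≢0 refl
  ∑≢0⇒∃≢0 (x ∷ xs) f ∑≢0 with f x ≟ zeroF
  ... | no fx≢0 = x , here refl , fx≢0
  ... | yes fx≡0 with y , y∈xs , fy≢0 ← ∑≢0⇒∃≢0 xs f (λ ∑≡0 → ∑≢0 (trans (cong₂ _+F_ fx≡0 ∑≡0) (+F-identityˡ zeroF)))
    = y , there y∈xs , fy≢0

  ∏-cong : ∀ (xs : List A) {f g : A → 𝔽} → (∀ x → f x ≡ g x) → ∏ xs f ≡ ∏ xs g
  ∏-cong []       eq = refl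
  ∏-cong (x ∷ xs) eq = cong₂ _*F_ (eq x) (∏-cong xs eq)

  ∏-zero : ∀ {xs : List A} (f : A → 𝔽) {x} → x ∈ xs → f x ≡ zeroF → ∏ xs f ≡ zeroF
  ∏-zero {xs = y ∷ xs} f (here refl) fx≡0 = x≡0⇒x*y≡0 (∏ xs f) fx≡0
  ∏-zero {xs = y ∷ xs} f (there x∈)  fx≡0 = y≡0⇒x*y≡0 (f y) (∏-zero f x∈ fx≡0)

module Domain (p : ℕ) .{{_ : NonZero p}} (prime : Prime p) where

  open All using (All; []; _∷_)

  open FiniteSums p

  oneF≢zeroF : oneF ≢ zeroF
  oneF≢zeroF = []≢0 (ℕ.s≤s ℕ.z≤n) (nonTrivial⇒n>1 p {{prime⇒nonTrivial prime}})

  *F-nonzero : ∀ {x y} → x ≢ zeroF → y ≢ zeroF → x *F y ≢ zeroF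
  *F-nonzero {x} {y} x≢0 y≢0 xy≡0 with euclidsLemma (toℕ x) (toℕ y) prime ([]≡0⇒∣ _ xy≡0)
  ... | inj₁ p∣x = x≢0 (∣toℕ⇒≡0 x p∣x)
  ... | inj₂ p∣y = y≢0 (∣toℕ⇒≡0 y p∣y)

  powF-nonzero : ∀ {x} k → x ≢ zeroF → powF x k ≢ zeroF
  powF-nonzero zero    x≢0 = oneF≢zeroF
  powF-nonzero (suc k) x≢0 = *F-nonzero x≢0 (powF-nonzero k x≢0)

  ∏-nonzero : ∀ {a} {A : Set a} {xs : List A} {f : A → 𝔽} → All (λ x → f x ≢ zeroF) xs → ∏ xs f ≢ zeroF
  ∏-nonzero []            = oneF≢zeroF
  ∏-nonzero (fx≢0 ∷ fxs≢0) = *F-nonzero fx≢0 (∏-nonzero fxs≢0)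

module Measures (p : ℕ) .{{_ : NonZero p}} where

  open All using (All; []; _∷_)

  open FiniteSums p public

  private
    variable
      n : ℕ

  -- Defs bounds exponents by n; products of monomials need exponents in ℕ.
  monomialℕ : Point p n → Vec ℕ n → 𝔽
  monomialℕ []       []       = oneF
  monomialℕ (x ∷ xs) (e ∷ es) = powF x e *F monomialℕ xs es

  monomial≡monomialℕ : ∀ (x : Point p n) (e : Exps n) → monomial x e ≡ monomialℕ x (Vec.map toℕ e)
  monomial≡monomialℕ = go
    where
    go : ∀ {m l} (x : Point p m) (e : Vec (Fin l) m) →
         Vec.foldr _ _*F_ oneF (zipWith (λ xᵢ eᵢ → powF xᵢ (toℕ eᵢ)) x e) ≡ monomialℕ x (Vec.map toℕ e)
    go []       []       = refl
    go (x ∷ xs) (e ∷ es) = cong (powF x (toℕ e) *F_) (go xs es)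

  powF-+ : ∀ x a b → powF x (a ℕ.+ b) ≡ powF x a *F powF x b
  powF-+ x zero    b = sym (*F-identityˡ _)
  powF-+ x (suc a) b = trans (cong (x *F_) (powF-+ x a b)) (sym (*F-assoc x (powF x a) (powF x b)))

  monomialℕ-zeros : ∀ (x : Point p n) → monomialℕ x (replicate n 0) ≡ oneF
  monomialℕ-zeros []       = refl
  monomialℕ-zeros (x ∷ xs) = trans (*F-identityˡ _) (monomialℕ-zeros xs)

  monomialℕ-+ : ∀ (x : Point p n) e e′ → monomialℕ x (zipWith ℕ._+_ e e′) ≡ monomialℕ x e *F monomialℕ x e′
  monomialℕ-+ []       []       []         = sym (*F-identityˡ oneF)
  monomialℕ-+ (x ∷ xs) (a ∷ e) (b ∷ e′) = trans (cong₂ _*F_ (powF-+ x a b) (monomialℕ-+ xs e e′))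
    (solve 4 (λ u v w z → (u :* v) :* (w :* z) := (u :* w) :* (v :* z)) refl
      (powF x a) (powF x b) (monomialℕ xs e) (monomialℕ xs e′))

  monomialℕ-unit : ∀ (x : Point p n) j → monomialℕ x (unit j) ≡ lookup x j
  monomialℕ-unit (x ∷ xs) Fin.zero    = trans (cong₂ _*F_ (*F-identityʳ x) (monomialℕ-zeros xs)) (*F-identityʳ x)
  monomialℕ-unit (x ∷ xs) (Fin.suc j) = trans (*F-identityˡ _) (monomialℕ-unit xs j)

  Measure : ℕ → Set
  Measure n = List (𝔽 × Point p n)

  ∫ : Measure n → (Point p n → 𝔽) → 𝔽
  ∫ μ f = ∑ μ (λ (w , x) → w *F f x)

  ∫-cong : ∀ (μ : Measure n) {f g : Point p n → 𝔽} → (∀ x → f x ≡ g x) → ∫ μ f ≡ ∫ μ g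
  ∫-cong μ eq = ∑-cong μ (λ (w , x) → cong (w *F_) (eq x))

  -- cubeMeasure t puts weight (-1)^∣b∣ on t + b for each b ∈ {0,1}ⁿ: integrating against it is, up to sign,
  -- the iterated finite difference Δ₁ ⋯ Δₙ at t, which kills every polynomial of degree below n.
  cube : (n : ℕ) → List (𝔽 × Vec ℕ n)
  cube zero    = (oneF , []) ∷ []
  cube (suc n) = map (λ (w , b) → w , 0 ∷ b) (cube n) ++ map (λ (w , b) → -F w , 1 ∷ b) (cube n)

  cubeMeasure : Point p n → Measure n
  cubeMeasure {n} t = map (λ (w , b) → w , t +V Vec.map [_] b) (cube n)

  cube-entries≤1 : ∀ n → All (λ (w , b) → VecAll (_≤ 1) b) (cube n)
  cube-entries≤1 zero    = []ᵛ ∷ []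
  cube-entries≤1 (suc n) = AllP.++⁺ (AllP.map⁺ (All.map (ℕ.z≤n ∷ᵛ_) (cube-entries≤1 n)))
                                    (AllP.map⁺ (All.map (ℕ.≤-refl ∷ᵛ_) (cube-entries≤1 n)))

  ∑-cube-suc : ∀ (Φ : Vec ℕ (suc n) → 𝔽) →
    ∑ (cube (suc n)) (λ (w , b) → w *F Φ b) ≡ ∑ (cube n) (λ (w , b) → w *F (Φ (0 ∷ b) +F (-F Φ (1 ∷ b))))
  ∑-cube-suc {n} Φ = trans (∑-++-map _ _ (cube n) _) (∑-cong (cube n) λ (w , b) →
    solve 3 (λ w u v → w :* u :+ (:- w) :* v := w :* (u :+ (:- v))) refl w (Φ (0 ∷ b)) (Φ (1 ∷ b)))

  ∑-cube-vanishing : ∀ (Φ : Vec ℕ n → 𝔽) → (∀ b j → lookup b j ≡ 1 → Φ b ≡ zeroF) →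
                     ∑ (cube n) (λ (w , b) → w *F Φ b) ≡ Φ (replicate n 0)
  ∑-cube-vanishing {zero}  Φ Φ-vanishes = trans (+F-identityʳ _) (*F-identityˡ _)
  ∑-cube-vanishing {suc n} Φ Φ-vanishes = begin
    ∑ (cube (suc n)) (λ (w , b) → w *F Φ b)                      ≡⟨ ∑-cube-suc Φ ⟩
    ∑ (cube n) (λ (w , b) → w *F (Φ (0 ∷ b) +F (-F Φ (1 ∷ b))))  ≡⟨ ∑-cong (cube n) (λ (w , b) → cong (w *F_) (drop-Φ₁ b)) ⟩
    ∑ (cube n) (λ (w , b) → w *F Φ (0 ∷ b))                      ≡⟨ ∑-cube-vanishing (λ b → Φ (0 ∷ b))
                                                                     (λ b j → Φ-vanishes (0 ∷ b) (Fin.suc j)) ⟩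
    Φ (replicate (suc n) 0)                                      ∎
    where
    open ≡-Reasoning
    drop-Φ₁ : ∀ b → Φ (0 ∷ b) +F (-F Φ (1 ∷ b)) ≡ Φ (0 ∷ b)
    drop-Φ₁ b = trans (cong (λ v → Φ (0 ∷ b) +F (-F v)) (Φ-vanishes (1 ∷ b) Fin.zero refl))
                      (trans (cong (Φ (0 ∷ b) +F_) -F0≡0) (+F-identityʳ _))

  ∫-cubeMeasure-∷ : ∀ (t : 𝔽) (ts : Point p n) e es →
    ∫ (cubeMeasure (t ∷ ts)) (λ x → monomialℕ x (e ∷ es)) ≡
    (powF (t +F [ 0 ]) e +F (-F powF (t +F [ 1 ]) e)) *F ∫ (cubeMeasure ts) (λ x → monomialℕ x es)
  ∫-cubeMeasure-∷ {n} t ts e es = begin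
    ∫ (cubeMeasure (t ∷ ts)) (λ x → monomialℕ x (e ∷ es))                  ≡⟨ ∑-map _ (cube (suc n)) _ ⟩
    ∑ (cube (suc n)) (λ (w , b) → w *F monomialℕ ((t ∷ ts) +V Vec.map [_] b) (e ∷ es))
                                                   ≡⟨ ∑-cube-suc (λ b → monomialℕ ((t ∷ ts) +V Vec.map [_] b) (e ∷ es)) ⟩
    ∑ (cube n) (λ (w , b) → w *F ((P₀ *F M b) +F (-F (P₁ *F M b))))       ≡⟨ ∑-cong (cube n) (λ (w , b) →
        solve 4 (λ w a c m → w :* (a :* m :+ (:- (c :* m))) := (a :+ (:- c)) :* (w :* m)) refl w P₀ P₁ (M b)) ⟩
    ∑ (cube n) (λ (w , b) → (P₀ +F (-F P₁)) *F (w *F M b))               ≡⟨ *F-distribˡ-∑ (cube n) (P₀ +F (-F P₁)) _ ⟨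
    (P₀ +F (-F P₁)) *F ∑ (cube n) (λ (w , b) → w *F M b)                 ≡⟨ cong ((P₀ +F (-F P₁)) *F_) (∑-map _ (cube n) _) ⟨
    (P₀ +F (-F P₁)) *F ∫ (cubeMeasure ts) (λ x → monomialℕ x es)         ∎
    where
    open ≡-Reasoning
    P₀ P₁ : 𝔽
    P₀ = powF (t +F [ 0 ]) e
    P₁ = powF (t +F [ 1 ]) e
    M : Vec ℕ n → 𝔽
    M b = monomialℕ (ts +V Vec.map [_] b) es

  ∫-cubeMeasure-monomialℕ : ∀ (t : Point p n) e → deg e < n → ∫ (cubeMeasure t) (λ x → monomialℕ x e) ≡ zeroF
  ∫-cubeMeasure-monomialℕ (t ∷ ts) (zero ∷ es) _ = trans (∫-cubeMeasure-∷ t ts 0 es)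
    (x≡0⇒x*y≡0 (∫ (cubeMeasure ts) (λ x → monomialℕ x es)) (-F-inverseʳ oneF))
  ∫-cubeMeasure-monomialℕ (t ∷ ts) (suc e ∷ es) deg<n = trans (∫-cubeMeasure-∷ t ts (suc e) es)
    (y≡0⇒x*y≡0 (powF (t +F [ 0 ]) (suc e) +F (-F powF (t +F [ 1 ]) (suc e)))
      (∫-cubeMeasure-monomialℕ ts es (ℕ.≤-trans (ℕ.s≤s (ℕ.m≤n+m (deg es) e)) (ℕ.≤-pred deg<n))))

module Polynomials (p : ℕ) .{{_ : NonZero p}} where

  open All using (All; []; _∷_)

  open Measures p public

  private
    variable
      n k : ℕ

  ∫^ : (k : ℕ) → Measure n → (Vec (Point p n) k → 𝔽) → 𝔽
  ∫^ zero    μ G = G []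
  ∫^ (suc k) μ G = ∫ μ (λ x → ∫^ k μ (λ xs → G (x ∷ xs)))

  ∫-*ʳ : ∀ (μ : Measure n) f c → ∫ μ (λ x → f x *F c) ≡ ∫ μ f *F c
  ∫-*ʳ μ f c = begin
    ∫ μ (λ x → f x *F c)             ≡⟨ ∑-cong μ (λ (w , x) → solve 3 (λ w f c → w :* (f :* c) := c :* (w :* f)) refl w (f x) c) ⟩
    ∑ μ (λ (w , x) → c *F (w *F f x)) ≡⟨ *F-distribˡ-∑ μ c _ ⟨
    c *F ∫ μ f                       ≡⟨ *F-comm c _ ⟩
    ∫ μ f *F c                       ∎
    where open ≡-Reasoning

  ∫^-cong : ∀ k (μ : Measure n) {G G′ : Vec (Point p n) k → 𝔽} → (∀ xs → G xs ≡ G′ xs) → ∫^ k μ G ≡ ∫^ k μ G′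
  ∫^-cong zero    μ eq = eq []
  ∫^-cong (suc k) μ eq = ∫-cong μ (λ x → ∫^-cong k μ (λ xs → eq (x ∷ xs)))

  ∫^-*F : ∀ k (μ : Measure n) c (G : Vec (Point p n) k → 𝔽) → ∫^ k μ (λ xs → c *F G xs) ≡ c *F ∫^ k μ G
  ∫^-*F zero    μ c G = refl
  ∫^-*F (suc k) μ c G = begin
    ∫ μ (λ x → ∫^ k μ (λ xs → c *F G (x ∷ xs)))   ≡⟨ ∫-cong μ (λ x → ∫^-*F k μ c (λ xs → G (x ∷ xs))) ⟩
    ∫ μ (λ x → c *F ∫^ k μ (λ xs → G (x ∷ xs)))   ≡⟨ ∫-cong μ (λ x → *F-comm c _) ⟩
    ∫ μ (λ x → ∫^ k μ (λ xs → G (x ∷ xs)) *F c)   ≡⟨ ∫-*ʳ μ _ c ⟩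
    ∫^ (suc k) μ G *F c                          ≡⟨ *F-comm _ c ⟩
    c *F ∫^ (suc k) μ G                          ∎
    where open ≡-Reasoning

  ∫^-∑ : ∀ {a} {T : Set a} k (μ : Measure n) (ts : List T) (g : T → Vec (Point p n) k → 𝔽) →
         ∫^ k μ (λ xs → ∑[ t ∈ ts ] g t xs) ≡ ∑[ t ∈ ts ] ∫^ k μ (g t)
  ∫^-∑ zero    μ ts g = refl
  ∫^-∑ (suc k) μ ts g = begin
    ∫ μ (λ x → ∫^ k μ (λ xs → ∑[ t ∈ ts ] g t (x ∷ xs)))      ≡⟨ ∫-cong μ (λ x → ∫^-∑ k μ ts (λ t xs → g t (x ∷ xs))) ⟩
    ∑ μ (λ (w , x) → w *F (∑[ t ∈ ts ] ∫^ k μ (λ xs → g t (x ∷ xs)))) ≡⟨ ∑-cong μ (λ (w , x) → *F-distribˡ-∑ ts w _) ⟩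
    ∑ μ (λ (w , x) → ∑[ t ∈ ts ] (w *F ∫^ k μ (λ xs → g t (x ∷ xs)))) ≡⟨ ∑-comm μ ts _ ⟩
    ∑[ t ∈ ts ] ∫^ (suc k) μ (g t)                             ∎
    where open ≡-Reasoning

  ∫^≢0⇒witness : ∀ {P : Point p n → Set} k (μ : Measure n) → All (λ (w , x) → P x) μ →
    (G : Vec (Point p n) k → 𝔽) → ∫^ k μ G ≢ zeroF → Σ[ xs ∈ Vec (Point p n) k ] VecAll P xs × G xs ≢ zeroF
  ∫^≢0⇒witness zero    μ Pμ G G≢0 = [] , []ᵛ , G≢0
  ∫^≢0⇒witness (suc k) μ Pμ G ∫≢0
    with (w , x) , wx∈μ , term≢0 ← ∑≢0⇒∃≢0 μ _ ∫≢0
    with xs , Pxs , G≢0 ← ∫^≢0⇒witness k μ Pμ (λ xs → G (x ∷ xs)) (λ ∫≡0 → term≢0 (y≡0⇒x*y≡0 w ∫≡0))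
    = x ∷ xs , All.lookup Pμ wx∈μ ∷ᵛ Pxs , G≢0

  monomials : Vec (Point p n) k → Vec (Vec ℕ n) k → 𝔽
  monomials []       []       = oneF
  monomials (x ∷ xs) (e ∷ es) = monomialℕ x e *F monomials xs es

  moments : Measure n → Vec (Vec ℕ n) k → 𝔽
  moments μ []       = oneF
  moments μ (e ∷ es) = ∫ μ (λ x → monomialℕ x e) *F moments μ es

  degs : Vec (Vec ℕ n) k → ℕ
  degs []       = 0
  degs (e ∷ es) = deg e ℕ.+ degs es

  ∫^-monomials : ∀ (μ : Measure n) (es : Vec (Vec ℕ n) k) → ∫^ k μ (λ xs → monomials xs es) ≡ moments μ es
  ∫^-monomials μ []       = refl
  ∫^-monomials {k = suc k} μ (e ∷ es) = begin
    ∫ μ (λ x → ∫^ k μ (λ xs → monomialℕ x e *F monomials xs es)) ≡⟨ ∫-cong μ (λ x →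
                                                                       ∫^-*F k μ (monomialℕ x e) (λ xs → monomials xs es)) ⟩
    ∫ μ (λ x → monomialℕ x e *F ∫^ k μ (λ xs → monomials xs es))  ≡⟨ ∫-cong μ (λ x → cong (monomialℕ x e *F_) (∫^-monomials μ es)) ⟩
    ∫ μ (λ x → monomialℕ x e *F moments μ es)                     ≡⟨ ∫-*ʳ μ _ (moments μ es) ⟩
    moments μ (e ∷ es)                                            ∎
    where open ≡-Reasoning

  record IsPolynomial (k b : ℕ) (G : Vec (Point p n) k → 𝔽) : Set where
    field
      terms   : List (𝔽 × Vec (Vec ℕ n) k)
      degree≤ : All (λ (c , es) → degs es ≤ b) terms
      expand  : ∀ xs → G xs ≡ ∑ terms (λ (c , es) → c *F monomials xs es)

  open IsPolynomial

  ∫^-expand : ∀ (μ : Measure n) {b G} (P : IsPolynomial k b G) →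
              ∫^ k μ G ≡ ∑ (terms P) (λ (c , es) → c *F moments μ es)
  ∫^-expand {k = k} μ P = begin
    ∫^ k μ _                                                       ≡⟨ ∫^-cong k μ (expand P) ⟩
    ∫^ k μ (λ xs → ∑ (terms P) (λ (c , es) → c *F monomials xs es)) ≡⟨ ∫^-∑ k μ (terms P) _ ⟩
    ∑ (terms P) (λ (c , es) → ∫^ k μ (λ xs → c *F monomials xs es)) ≡⟨ ∑-cong (terms P) (λ (c , es) →
                                                                        trans (∫^-*F k μ c _) (cong (c *F_) (∫^-monomials μ es))) ⟩
    ∑ (terms P) (λ (c , es) → c *F moments μ es)                   ∎
    where open ≡-Reasoning

  isPolynomial-ext : ∀ {b} {G G′ : Vec (Point p n) k → 𝔽} → IsPolynomial k b G → (∀ xs → G xs ≡ G′ xs) → IsPolynomial k b G′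
  isPolynomial-ext P eq = record { terms = terms P ; degree≤ = degree≤ P ; expand = λ xs → trans (sym (eq xs)) (expand P xs) }

  isPolynomial-weaken : ∀ {b b′} {G : Vec (Point p n) k → 𝔽} → b ≤ b′ → IsPolynomial k b G → IsPolynomial k b′ G
  isPolynomial-weaken b≤b′ P = record
    { terms = terms P ; degree≤ = All.map (λ d≤b → ℕ.≤-trans d≤b b≤b′) (degree≤ P) ; expand = expand P }

  isPolynomial-+ : ∀ {b} {G G′ : Vec (Point p n) k → 𝔽} → IsPolynomial k b G → IsPolynomial k b G′ →
                   IsPolynomial k b (λ xs → G xs +F G′ xs)
  isPolynomial-+ P P′ = record
    { terms   = terms P ++ terms P′
    ; degree≤ = AllP.++⁺ (degree≤ P) (degree≤ P′)
    ; expand  = λ xs → trans (cong₂ _+F_ (expand P xs) (expand P′ xs)) (sym (∑-++ (terms P) (terms P′) _))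
    }

  zeros : Vec (Vec ℕ n) k
  zeros = replicate _ (replicate _ 0)

  degs-zeros : ∀ k → degs (zeros {n} {k}) ≡ 0
  degs-zeros zero    = refl
  degs-zeros {n} (suc k) = trans (cong (ℕ._+ degs (zeros {n} {k})) (deg-replicate-0 n)) (degs-zeros {n} k)

  monomials-zeros : ∀ (xs : Vec (Point p n) k) → monomials xs zeros ≡ oneF
  monomials-zeros []       = refl
  monomials-zeros (x ∷ xs) = trans (cong₂ _*F_ (monomialℕ-zeros x) (monomials-zeros xs)) (*F-identityˡ oneF)

  isPolynomial-const : ∀ c → IsPolynomial {n} k 0 (λ _ → c)
  isPolynomial-const {k = k} c = record
    { terms   = (c , zeros) ∷ []
    ; degree≤ = ℕ.≤-reflexive (degs-zeros k) ∷ []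
    ; expand  = λ xs → sym (trans (+F-identityʳ _) (trans (cong (c *F_) (monomials-zeros xs)) (*F-identityʳ c)))
    }

  isPolynomial-head-coordinate : ∀ (j : Fin n) → IsPolynomial (suc k) 1 (λ xs → lookup (head xs) j)
  isPolynomial-head-coordinate {k = k} j = record
    { terms   = (oneF , unit j ∷ zeros) ∷ []
    ; degree≤ = ℕ.≤-reflexive (cong₂ ℕ._+_ (deg-unit j) (degs-zeros k)) ∷ []
    ; expand  = λ { (x ∷ xs) → sym (begin
        (oneF *F (monomialℕ x (unit j) *F monomials xs zeros)) +F zeroF ≡⟨ +F-identityʳ _ ⟩
        oneF *F (monomialℕ x (unit j) *F monomials xs zeros)            ≡⟨ *F-identityˡ _ ⟩
        monomialℕ x (unit j) *F monomials xs zeros                       ≡⟨ cong₂ _*F_ (monomialℕ-unit x j) (monomials-zeros xs) ⟩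
        lookup x j *F oneF                                              ≡⟨ *F-identityʳ _ ⟩
        lookup x j                                                      ∎) }
    }
    where open ≡-Reasoning

  isPolynomial-tail : ∀ {b} {G : Vec (Point p n) k → 𝔽} → IsPolynomial k b G → IsPolynomial (suc k) b (λ xs → G (tail xs))
  isPolynomial-tail {n = n} P = record
    { terms   = map (λ (c , es) → c , replicate n 0 ∷ es) (terms P)
    ; degree≤ = AllP.map⁺ (All.map (λ {(c , es)} d≤b → subst (_≤ _) (sym (cong (ℕ._+ degs es) (deg-replicate-0 n))) d≤b) (degree≤ P))
    ; expand  = λ { (x ∷ xs) → trans (expand P xs) (trans (∑-cong (terms P) (λ (c , es) →
        cong (c *F_) (sym (trans (cong (_*F monomials xs es) (monomialℕ-zeros x)) (*F-identityˡ _)))))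
        (sym (∑-map _ (terms P) _))) }
    }

  private
    _⊗_ : 𝔽 × Vec (Vec ℕ n) k → 𝔽 × Vec (Vec ℕ n) k → 𝔽 × Vec (Vec ℕ n) k
    (c , es) ⊗ (c′ , es′) = c *F c′ , zipWith (zipWith ℕ._+_) es es′

  degs-+ : ∀ (es es′ : Vec (Vec ℕ n) k) → degs (zipWith (zipWith ℕ._+_) es es′) ≡ degs es ℕ.+ degs es′
  degs-+ []       []         = refl
  degs-+ (e ∷ es) (e′ ∷ es′) = trans (cong₂ ℕ._+_ (deg-+ e e′) (degs-+ es es′)) (ℕ-+-interchange (deg e) (deg e′) (degs es) (degs es′))

  monomials-+ : ∀ (xs : Vec (Point p n) k) es es′ →
                monomials xs (zipWith (zipWith ℕ._+_) es es′) ≡ monomials xs es *F monomials xs es′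
  monomials-+ []       []       []         = sym (*F-identityˡ oneF)
  monomials-+ (x ∷ xs) (e ∷ es) (e′ ∷ es′) = trans (cong₂ _*F_ (monomialℕ-+ x e e′) (monomials-+ xs es es′))
    (solve 4 (λ u v w z → (u :* v) :* (w :* z) := (u :* w) :* (v :* z)) refl
      (monomialℕ x e) (monomialℕ x e′) (monomials xs es) (monomials xs es′))

  isPolynomial-* : ∀ {b b′} {G G′ : Vec (Point p n) k → 𝔽} → IsPolynomial k b G → IsPolynomial k b′ G′ →
                   IsPolynomial k (b ℕ.+ b′) (λ xs → G xs *F G′ xs)
  isPolynomial-* P P′ = record
    { terms   = cartesianProductWith _⊗_ (terms P) (terms P′)
    ; degree≤ = AllP.cartesianProductWith⁺ (setoid _) (setoid _) _⊗_ (terms P) (terms P′)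
        λ {(c , es)} {(c′ , es′)} s∈ t∈ → subst (_≤ _) (sym (degs-+ es es′))
          (ℕ.+-mono-≤ (All.lookup (degree≤ P) s∈) (All.lookup (degree≤ P′) t∈))
    ; expand  = λ xs → trans (cong₂ _*F_ (expand P xs) (expand P′ xs)) (sym (∑-cartesianProductWith _⊗_ (terms P) (terms P′) _ _ _
        λ (c , es) (c′ , es′) → trans (cong ((c *F c′) *F_) (monomials-+ xs es es′))
          (solve 4 (λ u v w z → (u :* v) :* (w :* z) := (u :* w) :* (v :* z)) refl c c′ (monomials xs es) (monomials xs es′))))
    }

  isPolynomial-∏ : ∀ {a} {T : Set a} {b} (ts : List T) (G : T → Vec (Point p n) k → 𝔽) →
                   (∀ t → IsPolynomial k b (G t)) → IsPolynomial k (List.length ts ℕ.* b) (λ xs → ∏[ t ∈ ts ] G t xs)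
  isPolynomial-∏ []       G P = isPolynomial-const oneF
  isPolynomial-∏ (t ∷ ts) G P = isPolynomial-* (P t) (isPolynomial-∏ ts G P)

  moments-vanish : ∀ (μ : Measure n) d → (∀ e → deg e < d → ∫ μ (λ x → monomialℕ x e) ≡ zeroF) →
                   (es : Vec (Vec ℕ n) k) → degs es < k ℕ.* d → moments μ es ≡ zeroF
  moments-vanish μ d vanishes (e ∷ es) degs<kd with deg e ℕ.<? d
  ... | yes deg<d = x≡0⇒x*y≡0 (moments μ es) (vanishes e deg<d)
  ... | no  deg≮d = y≡0⇒x*y≡0 (∫ μ (λ x → monomialℕ x e)) (moments-vanish μ d vanishes es
                      (ℕ.+-cancelˡ-< d _ _ (ℕ.≤-<-trans (ℕ.+-monoˡ-≤ (degs es) (ℕ.≮⇒≥ deg≮d)) degs<kd)))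

  -- A monomial x₁^e₁ ⋯ x_k^e_k of degree ≤ k d either has every ∣eᵢ∣ = d, where the moments of w are κ times
  -- those of ν, or some ∣eᵢ∣ < d, where both vanish.
  module MomentComparison (w ν : Measure n) (κ : 𝔽) (d : ℕ)
    (ν-vanishes : ∀ e → deg e < d → ∫ ν (λ x → monomialℕ x e) ≡ zeroF)
    (w≡κν : ∀ e → deg e ≤ d → ∫ w (λ x → monomialℕ x e) ≡ κ *F ∫ ν (λ x → monomialℕ x e)) where

    private
      ∫w ∫ν : Vec ℕ n → 𝔽
      ∫w e = ∫ w (λ x → monomialℕ x e)
      ∫ν e = ∫ ν (λ x → monomialℕ x e)

    w-vanishes : ∀ e → deg e < d → ∫ w (λ x → monomialℕ x e) ≡ zeroF
    w-vanishes e deg<d = trans (w≡κν e (ℕ.<⇒≤ deg<d)) (y≡0⇒x*y≡0 κ (ν-vanishes e deg<d))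

    moments-agree : ∀ (es : Vec (Vec ℕ n) k) → degs es ≤ k ℕ.* d → moments w es ≡ powF κ k *F moments ν es
    moments-agree []       _        = sym (*F-identityˡ oneF)
    moments-agree {suc k} (e ∷ es) degs≤kd with ℕ.<-cmp (deg e) d
    ... | tri< deg<d _ _ = trans (x≡0⇒x*y≡0 (moments w es) (w-vanishes e deg<d))
      (sym (y≡0⇒x*y≡0 (powF κ (suc k)) (x≡0⇒x*y≡0 (moments ν es) (ν-vanishes e deg<d))))
    ... | tri≈ _ deg≡d _ = begin
      ∫w e *F moments w es                        ≡⟨ cong₂ _*F_ (w≡κν e (ℕ.≤-reflexive deg≡d)) (moments-agree es degs-es≤) ⟩
      (κ *F ∫ν e) *F (powF κ k *F moments ν es)   ≡⟨ solve 4 (λ a b c m → (a :* b) :* (c :* m) := (a :* c) :* (b :* m)) refl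
                                                       κ (∫ν e) (powF κ k) (moments ν es) ⟩
      powF κ (suc k) *F (∫ν e *F moments ν es)    ∎
      where
      open ≡-Reasoning
      degs-es≤ : degs es ≤ k ℕ.* d
      degs-es≤ = ℕ.+-cancelˡ-≤ d _ _ (subst (λ a → a ℕ.+ degs es ≤ d ℕ.+ k ℕ.* d) deg≡d degs≤kd)
    ... | tri> _ _ d<deg = trans (y≡0⇒x*y≡0 (∫w e) (moments-vanish w d w-vanishes es degs-es<))
      (sym (y≡0⇒x*y≡0 (powF κ (suc k)) (y≡0⇒x*y≡0 (∫ν e) (moments-vanish ν d ν-vanishes es degs-es<))))
      where
      degs-es< : degs es < k ℕ.* d
      degs-es< = ℕ.+-cancelˡ-< d _ _ (ℕ.<-≤-trans (ℕ.+-monoˡ-< (degs es) d<deg) degs≤kd)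

    ∫^-agree : ∀ {G : Vec (Point p n) k → 𝔽} → IsPolynomial k (k ℕ.* d) G → ∫^ k w G ≡ powF κ k *F ∫^ k ν G
    ∫^-agree {k} P = begin
      ∫^ k w _                                                        ≡⟨ ∫^-expand w P ⟩
      ∑ (terms P) (λ (c , es) → c *F moments w es)                    ≡⟨ ∑-cong-All (All.map (λ {(c , es)} degs≤ →
                                                                           cong (c *F_) (moments-agree es degs≤)) (degree≤ P)) ⟩
      ∑ (terms P) (λ (c , es) → c *F (powF κ k *F moments ν es))      ≡⟨ ∑-cong (terms P) (λ (c , es) →
                                                                           solve 3 (λ a b c → a :* (b :* c) := b :* (a :* c))
                                                                             refl c (powF κ k) (moments ν es)) ⟩
      ∑ (terms P) (λ (c , es) → powF κ k *F (c *F moments ν es))      ≡⟨ *F-distribˡ-∑ (terms P) (powF κ k) _ ⟨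
      powF κ k *F ∑ (terms P) (λ (c , es) → c *F moments ν es)        ≡⟨ cong (powF κ k *F_) (∫^-expand ν P) ⟨
      powF κ k *F ∫^ k ν _                                            ∎
      where open ≡-Reasoning

module Indicator (p : ℕ) .{{_ : NonZero p}} (prime : Prime p) where

  open All using (All; []; _∷_)

  open Polynomials p public
  open Domain p prime public

  nonzeroResidues : List ℕ
  nonzeroResidues = map suc (upTo (p ∸ 1))

  ∈-nonzeroResidues : ∀ {m} → 0 < m → m ≤ p ∸ 1 → m ∈ nonzeroResidues
  ∈-nonzeroResidues {suc m} _ m<p∸1 = ∈-map⁺ suc (∈-upTo⁺ m<p∸1)

  nonzeroResidue-bounds : ∀ {m} → m ∈ nonzeroResidues → 0 < m × m < p
  nonzeroResidue-bounds m∈ with i , i∈ , refl ← ∈-map⁻ suc m∈ =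
    ℕ.s≤s ℕ.z≤n , subst (suc i <_) (ℕ.suc-pred p) (ℕ.s≤s (∈-upTo⁻ i∈))

  δ : 𝔽 → 𝔽
  δ d = ∏[ c ∈ nonzeroResidues ] ([ c ] +F (-F d))

  δ-[] : ∀ {m} → 0 < m → m ≤ p ∸ 1 → δ [ m ] ≡ zeroF
  δ-[] {m} 0<m m≤p∸1 = ∏-zero (λ c → [ c ] +F (-F [ m ])) (∈-nonzeroResidues 0<m m≤p∸1) (-F-inverseʳ [ m ])

  δ-zero≢0 : δ zeroF ≢ zeroF
  δ-zero≢0 = ∏-nonzero (All.tabulate λ {c} c∈ → let 0<c , c<p = nonzeroResidue-bounds c∈ in
    λ eq → []≢0 0<c c<p (trans (sym (trans (cong ([ c ] +F_) -F0≡0) (+F-identityʳ [ c ]))) eq))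

  δ≢0⇒≡0 : ∀ d → δ d ≢ zeroF → d ≡ zeroF
  δ≢0⇒≡0 d δ≢0 with d ≟ zeroF
  ... | yes d≡0 = d≡0
  ... | no  d≢0 = ⊥-elim (δ≢0 (subst (λ x → δ x ≡ zeroF) ([toℕ] d) (δ-[] 0<d (ℕ.<⇒≤pred (toℕ<n d)))))
    where
    0<d : 0 < toℕ d
    0<d = ℕ.n≢0⇒n>0 (λ d≡0 → d≢0 (toℕ-injective (trans d≡0 (sym toℕ-zeroF))))

  lookup-+V : ∀ {n} (u v : Point p n) j → lookup (u +V v) j ≡ lookup u j +F lookup v j
  lookup-+V u v j = Vec.lookup-zipWith _+F_ j u v

  offset-zero : ∀ u t yⱼ cⱼ → u +F ([ 0 ] *F t) ≡ yⱼ +F [ cⱼ ] → u +F (-F yⱼ) ≡ [ cⱼ ]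
  offset-zero u t yⱼ cⱼ eq = begin
    u +F (-F yⱼ)                    ≡⟨ solve 3 (λ u t y → u :+ (:- y) := (u :+ con (ℤ.+ 0) :* t) :+ (:- y)) refl u t yⱼ ⟩
    (u +F ([ 0 ] *F t)) +F (-F yⱼ)  ≡⟨ cong (_+F (-F yⱼ)) eq ⟩
    (yⱼ +F [ cⱼ ]) +F (-F yⱼ)       ≡⟨ solve 2 (λ y c → (y :+ c) :+ (:- y) := c) refl yⱼ [ cⱼ ] ⟩
    [ cⱼ ]                          ∎
    where open ≡-Reasoning

  offset-suc : ∀ u t yⱼ cⱼ bⱼ k → u +F ([ suc k ] *F t) ≡ yⱼ +F [ cⱼ ] →
               (u +F (t +F [ bⱼ ])) +F ([ k ] *F t) ≡ yⱼ +F [ cⱼ ℕ.+ bⱼ ]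
  offset-suc u t yⱼ cⱼ bⱼ k eq = begin
    (u +F (t +F [ bⱼ ])) +F ([ k ] *F t)       ≡⟨ solve 4 (λ u t b K → (u :+ (t :+ b)) :+ (K :* t) := (u :+ ((con (ℤ.+ 1) :+ K) :* t)) :+ b)
                                                    refl u t [ bⱼ ] [ k ] ⟩
    (u +F (([ 1 ] +F [ k ]) *F t)) +F [ bⱼ ]   ≡⟨ cong (λ v → (u +F (v *F t)) +F [ bⱼ ]) ([]-+ 1 k) ⟨
    (u +F ([ suc k ] *F t)) +F [ bⱼ ]          ≡⟨ cong (_+F [ bⱼ ]) eq ⟩
    (yⱼ +F [ cⱼ ]) +F [ bⱼ ]                   ≡⟨ +F-assoc yⱼ [ cⱼ ] [ bⱼ ] ⟩
    yⱼ +F ([ cⱼ ] +F [ bⱼ ])                   ≡⟨ cong (yⱼ +F_) ([]-+ cⱼ bⱼ) ⟨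
    yⱼ +F [ cⱼ ℕ.+ bⱼ ]                        ∎
    where open ≡-Reasoning

  -- Gᶜ c is the value of G (defined below) at y + c, for every y.
  Gᶜ : ∀ {n} → Vec ℕ n → 𝔽
  Gᶜ {n} c = ∏[ j ∈ allFin n ] δ [ lookup c j ]

  Gᶜ-zeros≢0 : ∀ {n} → Gᶜ (replicate n 0) ≢ zeroF
  Gᶜ-zeros≢0 {n} = ∏-nonzero {xs = allFin n} (All.tabulate λ {j} _ δ≡0 →
    δ-zero≢0 (trans (cong (λ m → δ [ m ]) (sym (Vec.lookup-replicate j 0))) δ≡0))

  module _ {n : ℕ} (y : Point p n) where

    G : Point p n → 𝔽
    G z = ∏[ j ∈ allFin n ] δ (lookup z j +F (-F lookup y j))

    G≢0⇒≡y : ∀ z → G z ≢ zeroF → z ≡ y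
    G≢0⇒≡y z G≢0 = trans (sym (Vec.tabulate∘lookup z)) (trans (Vec.tabulate-cong coordinate) (Vec.tabulate∘lookup y))
      where
      coordinate : ∀ j → lookup z j ≡ lookup y j
      coordinate j = begin
        lookup z j                                     ≡⟨ solve 2 (λ z y → z := (z :+ (:- y)) :+ y) refl (lookup z j) (lookup y j) ⟩
        (lookup z j +F (-F lookup y j)) +F lookup y j  ≡⟨ cong (_+F lookup y j) (δ≢0⇒≡0 _ (λ δ≡0 → G≢0 (∏-zero _ (∈-allFin j) δ≡0))) ⟩
        zeroF +F lookup y j                            ≡⟨ +F-identityˡ _ ⟩
        lookup y j                                     ∎
        where open ≡-Reasoning

    isPolynomial-affine-sum : ∀ k a (j : Fin n) → IsPolynomial k 1 (λ xs → a +F (-F lookup (sumPts xs) j))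
    isPolynomial-affine-sum zero    a j = isPolynomial-ext (isPolynomial-weaken ℕ.z≤n (isPolynomial-const (a +F (-F zeroF))))
      λ { [] → cong (λ v → a +F (-F v)) (sym (Vec.lookup-replicate j zeroF)) }
    isPolynomial-affine-sum (suc k) a j = isPolynomial-ext
      (isPolynomial-+ (isPolynomial-* (isPolynomial-const (-F oneF)) (isPolynomial-head-coordinate j))
                      (isPolynomial-tail (isPolynomial-affine-sum k a j)))
      λ { (x ∷ xs) → trans
          (solve 3 (λ u v a → (:- con (ℤ.+ 1)) :* u :+ (a :+ (:- v)) := a :+ (:- (u :+ v))) refl (lookup x j) (lookup (sumPts xs) j) a)
          (cong (λ v → a +F (-F v)) (sym (lookup-+V x (sumPts xs) j))) }

    isPolynomial-G∘sumPts : IsPolynomial (p ∸ 1) ((p ∸ 1) ℕ.* n) (λ xs → G (sumPts xs))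
    isPolynomial-G∘sumPts = isPolynomial-weaken (ℕ.≤-reflexive degree≡)
      (isPolynomial-∏ (allFin n) _ λ j → isPolynomial-∏ nonzeroResidues _ λ c →
        isPolynomial-ext (isPolynomial-affine-sum (p ∸ 1) ([ c ] +F lookup y j) j) λ xs →
          solve 3 (λ c y s → c :+ y :+ (:- s) := c :+ (:- (s :+ (:- y)))) refl [ c ] (lookup y j) (lookup (sumPts xs) j))
      where
      degree≡ : List.length (allFin n) ℕ.* (List.length nonzeroResidues ℕ.* 1) ≡ (p ∸ 1) ℕ.* n
      degree≡ = begin
        List.length (allFin n) ℕ.* (List.length nonzeroResidues ℕ.* 1) ≡⟨ cong₂ ℕ._*_ (List.length-tabulate {n = n} (λ j → j))
                                                                           (ℕ.*-identityʳ (List.length nonzeroResidues)) ⟩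
        n ℕ.* List.length nonzeroResidues                             ≡⟨ cong (n ℕ.*_) (trans (List.length-map suc (upTo (p ∸ 1)))
                                                                           (List.length-upTo (p ∸ 1))) ⟩
        n ℕ.* (p ∸ 1)                                                 ≡⟨ ℕ.*-comm n (p ∸ 1) ⟩
        (p ∸ 1) ℕ.* n                                                 ∎
        where open ≡-Reasoning

    -- The hypotheses say u + k t = y + c and c + k ≤ p - 1. A point of cubeMeasure t is t + b with b ∈ {0,1}ⁿ,
    -- so after k integrations G is evaluated at y + c + Σ bᵢ; this is 0 as soon as a coordinate of c + Σ bᵢ
    -- lies in 1 … p-1, and the signs (-1)^∣b∣ cancel everything except b = 0.
    ∫^-cubeMeasure-G : ∀ (t : Point p n) k (u : Point p n) (c : Vec ℕ n) →
      (∀ j → lookup u j +F ([ k ] *F lookup t j) ≡ lookup y j +F [ lookup c j ]) →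
      (∀ j → lookup c j ℕ.+ k ≤ p ∸ 1) →
      ∫^ k (cubeMeasure t) (λ xs → G (u +V sumPts xs)) ≡ Gᶜ c
    ∫^-cubeMeasure-G t zero u c offset _ = trans (cong G (Vec.zipWith-identityʳ +F-identityʳ u))
      (∏-cong (allFin n) λ j → cong δ (offset-zero (lookup u j) (lookup t j) (lookup y j) (lookup c j) (offset j)))
    ∫^-cubeMeasure-G t (suc k) u c offset bound = begin
      ∫ ν (λ x → ∫^ k ν (λ xs → G (u +V (x +V sumPts xs))))       ≡⟨ ∑-map _ (cube n) _ ⟩
      ∑ (cube n) (λ (w , b) → w *F ∫^ k ν (λ xs → G (u +V ((t +V [ b ]ᵛ) +V sumPts xs))))
                                                                   ≡⟨ ∑-cong-All (All.map (λ {(w , b)} b≤1 → cong (w *F_) (step b b≤1))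
                                                                        (cube-entries≤1 n)) ⟩
      ∑ (cube n) (λ (w , b) → w *F Gᶜ (zipWith ℕ._+_ c b))        ≡⟨ ∑-cube-vanishing (λ b → Gᶜ (zipWith ℕ._+_ c b)) vanishes ⟩
      Gᶜ (zipWith ℕ._+_ c (replicate n 0))                         ≡⟨ cong Gᶜ (Vec.zipWith-identityʳ ℕ.+-identityʳ c) ⟩
      Gᶜ c                                                         ∎
      where
      open ≡-Reasoning
      ν = cubeMeasure t
      [_]ᵛ : Vec ℕ n → Point p n
      [ b ]ᵛ = Vec.map [_] b

      lookup-c+b : ∀ b j → lookup (zipWith ℕ._+_ c b) j ≡ lookup c j ℕ.+ lookup b j
      lookup-c+b b j = Vec.lookup-zipWith ℕ._+_ j c b

      vanishes : ∀ b j → lookup b j ≡ 1 → Gᶜ (zipWith ℕ._+_ c b) ≡ zeroF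
      vanishes b j bⱼ≡1 = ∏-zero _ (∈-allFin j) (δ-[] (subst (0 <_) (sym cⱼ+bⱼ≡) (ℕ.m≤n+m 1 (lookup c j)))
        (subst (_≤ p ∸ 1) (sym cⱼ+bⱼ≡) (ℕ.≤-trans (ℕ.+-monoʳ-≤ (lookup c j) (ℕ.s≤s ℕ.z≤n)) (bound j))))
        where cⱼ+bⱼ≡ = trans (lookup-c+b b j) (cong (lookup c j ℕ.+_) bⱼ≡1)

      offset′ : ∀ b j → lookup (u +V (t +V [ b ]ᵛ)) j +F ([ k ] *F lookup t j) ≡ lookup y j +F [ lookup (zipWith ℕ._+_ c b) j ]
      offset′ b j = begin
        lookup (u +V (t +V [ b ]ᵛ)) j +F ([ k ] *F lookup t j)            ≡⟨ cong (_+F ([ k ] *F lookup t j)) (trans (lookup-+V u _ j)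
                                                                              (cong (lookup u j +F_) (trans (lookup-+V t [ b ]ᵛ j)
                                                                                (cong (lookup t j +F_) (Vec.lookup-map j [_] b))))) ⟩
        (lookup u j +F (lookup t j +F [ lookup b j ])) +F ([ k ] *F lookup t j)
          ≡⟨ offset-suc (lookup u j) (lookup t j) (lookup y j) (lookup c j) (lookup b j) k (offset j) ⟩
        lookup y j +F [ lookup c j ℕ.+ lookup b j ]                       ≡⟨ cong (λ m → lookup y j +F [ m ]) (lookup-c+b b j) ⟨
        lookup y j +F [ lookup (zipWith ℕ._+_ c b) j ]                    ∎

      bound′ : ∀ b → VecAll (_≤ 1) b → ∀ j → lookup (zipWith ℕ._+_ c b) j ℕ.+ k ≤ p ∸ 1
      bound′ b b≤1 j = subst (λ m → m ℕ.+ k ≤ p ∸ 1) (sym (lookup-c+b b j))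
        (ℕ.≤-trans (ℕ.≤-reflexive (ℕ.+-assoc (lookup c j) (lookup b j) k))
          (ℕ.≤-trans (ℕ.+-monoʳ-≤ (lookup c j) (ℕ.+-monoˡ-≤ k (VecAll.lookup⁺ b≤1 j))) (bound j)))

      step : ∀ b → VecAll (_≤ 1) b → ∫^ k ν (λ xs → G (u +V ((t +V [ b ]ᵛ) +V sumPts xs))) ≡ Gᶜ (zipWith ℕ._+_ c b)
      step b b≤1 = trans (∫^-cong k ν (λ xs → cong G (sym (Vec.zipWith-assoc +F-assoc u _ (sumPts xs)))))
        (∫^-cubeMeasure-G t k (u +V (t +V [ b ]ᵛ)) (zipWith ℕ._+_ c b) (offset′ b) (bound′ b b≤1))

    ∫^-cubeMeasure-G∘sumPts≢0 : ∫^ (p ∸ 1) (cubeMeasure (Vec.map -F_ y)) (λ xs → G (sumPts xs)) ≢ zeroF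
    ∫^-cubeMeasure-G∘sumPts≢0 ∫≡0 = Gᶜ-zeros≢0 {n} (trans (sym value) ∫≡0)
      where
      t = Vec.map -F_ y
      offset : ∀ j → lookup vzero j +F ([ p ∸ 1 ] *F lookup t j) ≡ lookup y j +F [ lookup (replicate n 0) j ]
      offset j = begin
        lookup vzero j +F ([ p ∸ 1 ] *F lookup t j)  ≡⟨ cong₂ (λ z v → z +F ([ p ∸ 1 ] *F v))
                                                          (Vec.lookup-replicate j zeroF) (Vec.lookup-map j -F_ y) ⟩
        zeroF +F ([ p ∸ 1 ] *F (-F lookup y j))      ≡⟨ cong (λ v → zeroF +F (v *F (-F lookup y j))) [p∸1]≡-1 ⟩
        zeroF +F ((-F oneF) *F (-F lookup y j))      ≡⟨ solve 1 (λ y → con (ℤ.+ 0) :+ (:- con (ℤ.+ 1)) :* (:- y) := y :+ con (ℤ.+ 0))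
                                                          refl (lookup y j) ⟩
        lookup y j +F [ 0 ]                          ≡⟨ cong (λ m → lookup y j +F [ m ]) (Vec.lookup-replicate j 0) ⟨
        lookup y j +F [ lookup (replicate n 0) j ]   ∎
        where open ≡-Reasoning
      value : ∫^ (p ∸ 1) (cubeMeasure t) (λ xs → G (sumPts xs)) ≡ Gᶜ (replicate n 0)
      value = trans (∫^-cong (p ∸ 1) (cubeMeasure t) (λ xs → cong G (sym (Vec.zipWith-identityˡ +F-identityˡ (sumPts xs)))))
        (∫^-cubeMeasure-G t (p ∸ 1) vzero (replicate n 0) offset
          (λ j → ℕ.≤-reflexive (cong (ℕ._+ (p ∸ 1)) (Vec.lookup-replicate j 0))))

module FredholmAlternative (p : ℕ) .{{_ : NonZero p}} (prime : Prime p)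
  {ℓ : Level} {C : Set ℓ} (_≟C_ : DecidableEquality C)
  (Span : (C → Fin p) → Set)
  (span-zero : Span (λ _ → zeroF))
  (span-lincomb : ∀ {u v} α β → Span u → Span v → Span (λ x → (α *F u x) +F (β *F v x))) where

  open All using (All; []; _∷_)

  open FiniteSums p
  open Domain p prime

  dot : List C → (C → 𝔽) → (C → 𝔽) → 𝔽
  dot E c r = ∑[ e ∈ E ] (c e *F r e)

  record Solution (E : List C) (rows : List (C → 𝔽)) (t : C → 𝔽) : Set ℓ where
    field
      v          : C → 𝔽
      v∈span     : Span v
      κ          : 𝔽
      κ≢0        : κ ≢ zeroF
      v≡κt       : ∀ e → e ∈ E → v e ≡ κ *F t e
      -- the invariant that lets a solution for the reduced rows be lifted through a pivot
      v-vanishes : ∀ e → All (λ r → r e ≡ zeroF) rows → v e ≡ zeroF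

  record Obstruction (E : List C) (rows : List (C → 𝔽)) (t : C → 𝔽) : Set ℓ where
    field
      c      : C → 𝔽
      c⊥rows : All (λ r → dot E c r ≡ zeroF) rows
      c·t≢0  : dot E c t ≢ zeroF

  update : C → 𝔽 → (C → 𝔽) → C → 𝔽
  update e a f x with x ≟C e
  ... | yes _ = a
  ... | no  _ = f x

  dot-update : ∀ e a f E r → All (e ≢_) E → dot (e ∷ E) (update e a f) r ≡ (a *F r e) +F dot E f r
  dot-update e a f E r e∉E = cong₂ _+F_ (cong (_*F r e) update-at-e)
    (∑-cong-All (All.map (λ e≢x → cong (_*F r _) (update-elsewhere e≢x)) e∉E))
    where
    update-at-e : update e a f e ≡ a
    update-at-e with e ≟C e
    ... | yes _   = refl
    ... | no  e≢e = ⊥-elim (e≢e refl)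
    update-elsewhere : ∀ {x} → e ≢ x → update e a f x ≡ f x
    update-elsewhere {x} e≢x with x ≟C e
    ... | yes x≡e = ⊥-elim (e≢x (sym x≡e))
    ... | no  _   = refl

  dot-zeroˡ : ∀ E r → dot E (λ _ → zeroF) r ≡ zeroF
  dot-zeroˡ E r = ∑-zero {xs = E} (All.tabulate (λ {x} _ → *F-zeroˡ (r x)))

  dot-lincomb : ∀ E f α β u w → dot E f (λ x → (α *F u x) +F (β *F w x)) ≡ (α *F dot E f u) +F (β *F dot E f w)
  dot-lincomb E f α β u w = begin
    ∑[ x ∈ E ] (f x *F ((α *F u x) +F (β *F w x)))               ≡⟨ ∑-cong E (λ x → solve 5 (λ f a b u w →
                                                                      f :* (a :* u :+ b :* w) := a :* (f :* u) :+ b :* (f :* w))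
                                                                    refl (f x) α β (u x) (w x)) ⟩
    ∑[ x ∈ E ] ((α *F (f x *F u x)) +F (β *F (f x *F w x)))      ≡⟨ ∑-distrib-+F E _ _ ⟩
    (∑[ x ∈ E ] (α *F (f x *F u x))) +F (∑[ x ∈ E ] (β *F (f x *F w x))) ≡⟨ cong₂ _+F_ (*F-distribˡ-∑ E α _) (*F-distribˡ-∑ E β _) ⟨
    (α *F dot E f u) +F (β *F dot E f w)                         ∎
    where open ≡-Reasoning

  open Solution
  open Obstruction

  module _ {e : C} {E : List C} {rows : List (C → 𝔽)} {t : C → 𝔽} (rows-vanish : All (λ r → r e ≡ zeroF) rows) where

    obstruction-at : All (e ≢_) E → t e ≢ zeroF → Obstruction (e ∷ E) rows t
    obstruction-at e∉E te≢0 = record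
      { c      = indicator
      ; c⊥rows = All.map (λ {r} re≡0 → trans (dot-indicator r) re≡0) rows-vanish
      ; c·t≢0  = λ dot≡0 → te≢0 (trans (sym (dot-indicator t)) dot≡0)
      }
      where
      indicator = update e oneF (λ _ → zeroF)
      dot-indicator : ∀ r → dot (e ∷ E) indicator r ≡ r e
      dot-indicator r = trans (dot-update e oneF _ E r e∉E)
        (trans (cong₂ _+F_ (*F-identityˡ (r e)) (dot-zeroˡ E r)) (+F-identityʳ (r e)))

    private
      dot-extend : ∀ f {r} → r e ≡ zeroF → dot (e ∷ E) f r ≡ dot E f r
      dot-extend f {r} re≡0 = trans (cong (λ z → (f e *F z) +F dot E f r) re≡0)
        (trans (cong (_+F dot E f r) (*F-zeroʳ (f e))) (+F-identityˡ _))

    extend-solution : t e ≡ zeroF → Solution E rows t → Solution (e ∷ E) rows t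
    extend-solution te≡0 S = record
      { v = v S ; v∈span = v∈span S ; κ = κ S ; κ≢0 = κ≢0 S ; v-vanishes = v-vanishes S
      ; v≡κt = λ { x (here refl) → trans (v-vanishes S e rows-vanish) (sym (trans (cong (κ S *F_) te≡0) (*F-zeroʳ (κ S))))
                 ; x (there x∈E) → v≡κt S x x∈E }
      }

    extend-obstruction : t e ≡ zeroF → Obstruction E rows t → Obstruction (e ∷ E) rows t
    extend-obstruction te≡0 O = record
      { c      = c O
      ; c⊥rows = All.zipWith (λ (re≡0 , ⊥) → trans (dot-extend (c O) re≡0) ⊥) (rows-vanish , c⊥rows O)
      ; c·t≢0  = λ dot≡0 → c·t≢0 O (trans (sym (dot-extend (c O) te≡0)) dot≡0)
      }

  module Pivot (e : C) (E : List C) (rows : List (C → 𝔽)) (t : C → 𝔽) (pivot : C → 𝔽) where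

    a : 𝔽
    a = pivot e

    eliminate : (C → 𝔽) → C → 𝔽
    eliminate r x = (a *F r x) +F ((-F r e) *F pivot x)

    eliminate-at-e : ∀ r → eliminate r e ≡ zeroF
    eliminate-at-e r = solve 2 (λ a b → a :* b :+ (:- b) :* a := con (ℤ.+ 0)) refl a (r e)

    lift-solution : pivot ∈ rows → Span pivot → a ≢ zeroF →
                    Solution E (map eliminate rows) (eliminate t) → Solution (e ∷ E) rows t
    lift-solution pivot∈rows pivot∈span a≢0 S = record
      { v          = v′
      ; v∈span     = span-lincomb oneF β (v∈span S) pivot∈span
      ; κ          = κ S *F a
      ; κ≢0        = *F-nonzero (κ≢0 S) a≢0
      ; v≡κt       = λ { x (here refl) → at-e ; x (there x∈E) → on-E x x∈E }
      ; v-vanishes = vanishes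
      }
      where
      β : 𝔽
      β = κ S *F t e
      v′ : C → 𝔽
      v′ x = (oneF *F v S x) +F (β *F pivot x)

      at-e : v′ e ≡ (κ S *F a) *F t e
      at-e = trans (cong (λ z → (oneF *F z) +F (β *F a)) (v-vanishes S e (AllP.map⁺ (All.tabulate (λ {r} _ → eliminate-at-e r)))))
        (solve 3 (λ k te a → con (ℤ.+ 1) :* con (ℤ.+ 0) :+ (k :* te) :* a := (k :* a) :* te) refl (κ S) (t e) a)

      on-E : ∀ x → x ∈ E → v′ x ≡ (κ S *F a) *F t x
      on-E x x∈E = trans (cong (λ z → (oneF *F z) +F (β *F pivot x)) (v≡κt S x x∈E))
        (solve 5 (λ k a tx te px → con (ℤ.+ 1) :* (k :* (a :* tx :+ (:- te) :* px)) :+ (k :* te) :* px := (k :* a) :* tx)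
          refl (κ S) a (t x) (t e) (pivot x))

      vanishes : ∀ x → All (λ r → r x ≡ zeroF) rows → v′ x ≡ zeroF
      vanishes x rows-vanish = trans (cong₂ _+F_ (y≡0⇒x*y≡0 oneF (v-vanishes S x eliminated-vanish)) (y≡0⇒x*y≡0 β pivot-x≡0))
        (+F-identityˡ zeroF)
        where
        pivot-x≡0 = All.lookup rows-vanish pivot∈rows
        eliminated-vanish : All (λ r → r x ≡ zeroF) (map eliminate rows)
        eliminated-vanish = AllP.map⁺ (All.map (λ {r} rx≡0 →
          trans (cong₂ _+F_ (y≡0⇒x*y≡0 a rx≡0) (y≡0⇒x*y≡0 (-F r e) pivot-x≡0)) (+F-identityˡ zeroF)) rows-vanish)

    lift-obstruction : All (e ≢_) E → Obstruction E (map eliminate rows) (eliminate t) → Obstruction (e ∷ E) rows t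
    lift-obstruction e∉E O = record
      { c      = c′
      ; c⊥rows = All.map (λ {r} ⊥ → trans (dot-c′ r) ⊥) (AllP.map⁻ (c⊥rows O))
      ; c·t≢0  = λ dot≡0 → c·t≢0 O (trans (sym (dot-c′ t)) dot≡0)
      }
      where
      s : 𝔽
      s = dot E (c O) pivot
      c′ : C → 𝔽
      c′ = update e (-F s) (λ x → a *F c O x)
      dot-c′ : ∀ r → dot (e ∷ E) c′ r ≡ dot E (c O) (eliminate r)
      dot-c′ r = begin
        dot (e ∷ E) c′ r                              ≡⟨ dot-update e (-F s) _ E r e∉E ⟩
        ((-F s) *F r e) +F dot E (λ x → a *F c O x) r ≡⟨ cong (((-F s) *F r e) +F_)
                                                          (trans (∑-cong E (λ x → *F-assoc a (c O x) (r x)))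
                                                            (sym (*F-distribˡ-∑ E a _))) ⟩
        ((-F s) *F r e) +F (a *F dot E (c O) r)       ≡⟨ solve 4 (λ s re a d → (:- s) :* re :+ a :* d := a :* d :+ (:- re) :* s)
                                                           refl s (r e) a (dot E (c O) r) ⟩
        (a *F dot E (c O) r) +F ((-F r e) *F s)       ≡⟨ dot-lincomb E (c O) a (-F r e) r pivot ⟨
        dot E (c O) (eliminate r)                     ∎
        where open ≡-Reasoning

  fredholm : ∀ E → Unique E → ∀ rows → All Span rows → ∀ t → Solution E rows t ⊎ Obstruction E rows t
  fredholm []      _           rows spans t = inj₁ record
    { v = λ _ → zeroF ; v∈span = span-zero ; κ = oneF ; κ≢0 = oneF≢zeroF ; v≡κt = λ _ () ; v-vanishes = λ _ _ → refl }
  fredholm (e ∷ E) (e∉E ∷ uniq) rows spans t with All.all? (λ r → r e ≟ zeroF) rows | t e ≟ zeroF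
  ... | yes rows-vanish | no te≢0  = inj₂ (obstruction-at rows-vanish e∉E te≢0)
  ... | yes rows-vanish | yes te≡0 =
    Sum.map (extend-solution rows-vanish te≡0) (extend-obstruction rows-vanish te≡0) (fredholm E uniq rows spans t)
  ... | no ¬rows-vanish | _
    with pivot , pivot∈rows , a≢0 ← find (AllP.¬All⇒Any¬ (λ r → r e ≟ zeroF) rows ¬rows-vanish) =
    Sum.map (lift-solution pivot∈rows pivot∈span a≢0) (lift-obstruction e∉E)
      (fredholm E uniq (map eliminate rows)
        (AllP.map⁺ (All.map (λ {r} r∈span → span-lincomb a (-F r e) r∈span pivot∈span) spans)) (eliminate t))
    where
    open Pivot e E rows t pivot
    pivot∈span = All.lookup spans pivot∈rows

module SumsetCovering (p : ℕ) .{{_ : NonZero p}} (prime : Prime p) {n : ℕ} (A : Point p n → Bool)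
  (A-not-in-zero-set : (P : PolyDegLe p n) → NonzeroPoly P → ¬ (∀ x → A x ≡ true → eval P x ≡ zeroF)) where

  open All using (All; []; _∷_)

  open Indicator p prime

  lowDegree : List (Exps n)
  lowDegree = filter (λ e → totalDeg e ℕ.≤? n) (allVecs n)

  pointsOfA : List (Point p n)
  pointsOfA = filter (λ x → A x Bool.≟ true) (allVecs n)

  MomentVector : (Exps n → 𝔽) → Set
  MomentVector v = Σ[ w ∈ Measure n ] All (λ (_ , x) → A x ≡ true) w × (∀ e → v e ≡ ∫ w (λ x → monomial x e))

  momentVector-zero : MomentVector (λ _ → zeroF)
  momentVector-zero = [] , [] , λ _ → refl

  momentVector-lincomb : ∀ {u v} α β → MomentVector u → MomentVector v → MomentVector (λ e → (α *F u e) +F (β *F v e))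
  momentVector-lincomb {u} {v} α β (w , w⊆A , u≡∫w) (w′ , w′⊆A , v≡∫w′) =
    scale α w ++ scale β w′ , AllP.++⁺ (AllP.map⁺ w⊆A) (AllP.map⁺ w′⊆A) , λ e → begin
      (α *F u e) +F (β *F v e)                      ≡⟨ cong₂ (λ s s′ → (α *F s) +F (β *F s′)) (u≡∫w e) (v≡∫w′ e) ⟩
      (α *F ∫ w (m e)) +F (β *F ∫ w′ (m e))         ≡⟨ cong₂ _+F_ (∫-scale α w e) (∫-scale β w′ e) ⟨
      ∫ (scale α w) (m e) +F ∫ (scale β w′) (m e)   ≡⟨ ∑-++ (scale α w) (scale β w′) _ ⟨
      ∫ (scale α w ++ scale β w′) (m e)             ∎
    where
    open ≡-Reasoning
    m : Exps n → Point p n → 𝔽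
    m e x = monomial x e
    scale : 𝔽 → Measure n → Measure n
    scale α = map (λ (w , x) → α *F w , x)
    ∫-scale : ∀ α w e → ∫ (scale α w) (m e) ≡ α *F ∫ w (m e)
    ∫-scale α w e = trans (∑-map _ w _) (trans (∑-cong w (λ (w , x) → *F-assoc α w (m e x))) (sym (*F-distribˡ-∑ w α _)))

  open FredholmAlternative p prime (Vec.≡-dec Fin._≟_) MomentVector momentVector-zero momentVector-lincomb
  open Solution
  open Obstruction

  ∈-monomialA : All MomentVector (map monomial pointsOfA)
  ∈-monomialA = AllP.map⁺ (All.tabulate λ {x} x∈ →
    (oneF , x) ∷ [] , proj₂ (∈-filter⁻ (λ x → A x Bool.≟ true) {xs = allVecs n} x∈) ∷ [] ,
    λ e → sym (trans (+F-identityʳ _) (*F-identityˡ (monomial x e))))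

  polynomialWith : (Exps n → 𝔽) → PolyDegLe p n
  polynomialWith c = record
    { coeff    = λ e → if does (totalDeg e ℕ.≤? n) then c e else zeroF
    ; degBound = λ e n<deg → cong (λ b → if b then c e else zeroF) (dec-false (totalDeg e ℕ.≤? n) (ℕ.<⇒≱ n<deg))
    }

  eval-polynomialWith : ∀ c x → eval (polynomialWith c) x ≡ dot lowDegree c (monomial x)
  eval-polynomialWith c x = trans (∑-cong (allVecs n) (λ e → if-*F (does (totalDeg e ℕ.≤? n)) (c e) (monomial x e)))
    (∑-filter (λ e → totalDeg e ℕ.≤? n) (allVecs n) (λ e → c e *F monomial x e))
    where
    if-*F : ∀ b u m → (if b then u else zeroF) *F m ≡ (if b then u *F m else zeroF)
    if-*F true  u m = refl
    if-*F false u m = *F-zeroˡ m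

  no-obstruction : ∀ {t} → ¬ Obstruction lowDegree (map monomial pointsOfA) t
  no-obstruction {t} O = A-not-in-zero-set (polynomialWith (c O)) nonzero vanishes
    where
    vanishes : ∀ x → A x ≡ true → eval (polynomialWith (c O)) x ≡ zeroF
    vanishes x Ax = trans (eval-polynomialWith (c O) x)
      (All.lookup (c⊥rows O) (∈-map⁺ monomial (∈-filter⁺ (λ x → A x Bool.≟ true) (∈-allVecs n x) Ax)))
    nonzero : NonzeroPoly (polynomialWith (c O))
    nonzero with e , e∈ , ce·te≢0 ← ∑≢0⇒∃≢0 lowDegree (λ e → c O e *F t e) (c·t≢0 O) = e , λ coeff≡0 →
      ce·te≢0 (x≡0⇒x*y≡0 (t e) (trans (sym (coeff≡ce e∈)) coeff≡0))
      where
      coeff≡ce : ∀ {e} → e ∈ lowDegree → coeff (polynomialWith (c O)) e ≡ c O e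
      coeff≡ce {e} e∈ = cong (λ b → if b then c O e else zeroF)
        (dec-true (totalDeg e ℕ.≤? n) (proj₂ (∈-filter⁻ (λ e → totalDeg e ℕ.≤? n) {xs = allVecs n} e∈)))

  module _ (y : Point p n) where

    ν : Measure n
    ν = cubeMeasure (Vec.map -F_ y)

    moments-of-ν : Exps n → 𝔽
    moments-of-ν e = ∫ ν (λ x → monomial x e)

    covered-by-proportional-measure : ∀ (w : Measure n) κ → All (λ (_ , x) → A x ≡ true) w → κ ≢ zeroF →
      (∀ e → deg e ≤ n → ∫ w (λ x → monomialℕ x e) ≡ κ *F ∫ ν (λ x → monomialℕ x e)) →
      Σ[ xs ∈ Vec (Point p n) (p ∸ 1) ] VecAll (λ x → A x ≡ true) xs × sumPts xs ≡ y
    covered-by-proportional-measure w κ w⊆A κ≢0 w≡κν =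
      let xs , xs⊆A , H≢0 = ∫^≢0⇒witness (p ∸ 1) w w⊆A (λ xs → G y (sumPts xs)) ∫^w≢0
      in xs , xs⊆A , G≢0⇒≡y y (sumPts xs) H≢0
      where
      open MomentComparison w ν κ n (∫-cubeMeasure-monomialℕ (Vec.map -F_ y)) w≡κν
      ∫^w≢0 : ∫^ (p ∸ 1) w (λ xs → G y (sumPts xs)) ≢ zeroF
      ∫^w≢0 ∫≡0 = *F-nonzero (powF-nonzero (p ∸ 1) κ≢0) (∫^-cubeMeasure-G∘sumPts≢0 y)
        (trans (sym (∫^-agree (isPolynomial-G∘sumPts y))) ∫≡0)

    solution⇒proportional : (S : Solution lowDegree (map monomial pointsOfA) moments-of-ν) →
      let w , _ = v∈span S in ∀ e → deg e ≤ n → ∫ w (λ x → monomialℕ x e) ≡ κ S *F ∫ ν (λ x → monomialℕ x e)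
    solution⇒proportional S e deg≤n = begin
      ∫ w (λ x → monomialℕ x e)        ≡⟨ ∫-cong w as-monomial ⟩
      ∫ w (λ x → monomial x e′)        ≡⟨ v≡∫w e′ ⟨
      v S e′                           ≡⟨ v≡κt S e′ (∈-filter⁺ (λ e → totalDeg e ℕ.≤? n) (∈-allVecs n e′) deg-e′≤n) ⟩
      κ S *F moments-of-ν e′           ≡⟨ cong (κ S *F_) (∫-cong ν as-monomial) ⟨
      κ S *F ∫ ν (λ x → monomialℕ x e) ∎
      where
      open ≡-Reasoning
      w = proj₁ (v∈span S)
      v≡∫w = proj₂ (proj₂ (v∈span S))
      e′ = boundedExps n e deg≤n
      as-monomial : ∀ x → monomialℕ x e ≡ monomial x e′
      as-monomial x = trans (cong (monomialℕ x) (sym (toℕ-boundedExps n e deg≤n))) (sym (monomial≡monomialℕ x e′))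
      deg-e′≤n : totalDeg e′ ≤ n
      deg-e′≤n = subst (_≤ n) (cong deg (sym (toℕ-boundedExps n e deg≤n))) deg≤n

    sumset-covers : Σ[ xs ∈ Vec (Point p n) (p ∸ 1) ] VecAll (λ x → A x ≡ true) xs × sumPts xs ≡ y
    sumset-covers with fredholm lowDegree (Unique.filter⁺ _ (allVecs-unique n)) (map monomial pointsOfA) ∈-monomialA moments-of-ν
    ... | inj₁ S = let w , w⊆A , _ = v∈span S in covered-by-proportional-measure w (κ S) w⊆A (κ≢0 S) (solution⇒proportional S)
    ... | inj₂ O = ⊥-elim (no-obstruction O)

open import Data.Vec.Relation.Unary.All using (All)

theorem1p2 : (p n : ℕ) .{{_ : NonZero p}} → Prime p → 1 ≤ n →
    (A : Point p n → Bool) →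
    ((P : PolyDegLe p n) → NonzeroPoly P →
       ¬ (∀ (x : Point p n) → A x ≡ true → eval P x ≡ zeroF)) →
    ∀ (y : Point p n) → ∃ λ (as : Vec (Point p n) (p ∸ 1)) →
      All (λ a → A a ≡ true) as × sumPts as ≡ y
theorem1p2 p n p-prime _ A A-not-in-zero-set y = SumsetCovering.sumset-covers p p-prime A A-not-in-zero-set y
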